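{- For any standard tableau $\mathcal T$ of degree $n$ with $\mathcal T_{\{1,2\}}=21$, $$\overset{*}{\mathbb B}{}_2^{(1)}\mathcal T=R_{n-1}\bar\sigma_{n-2}\cdots\bar\sigma_1\,r_{(10\to11)}\,\tau_{ -1}\mathcal T.$$
   Context: Tableaux: a tableau $(\lambda,w)$ is the diagram of $\lambda$ (French convention, rows from the bottom) filled with the letters of the word $w$ left to right, top row first; $w$ is the reading word. Semi-standard: rows weakly increasing, columns strictly increasing upward; standard: semi-standard with letters $1,\dots,n$ each once. $\mathcal T_S$ is the subword of letters in $S$. Transpose $\mathcal T^t$: reflect in the main diagonal. Products act right to left; word operations act on reading words keeping shape: $\tau_k$ adds $k$ to every letter; $\sigma_i$ ($a=i,b=i+1$), defined when the subword on $\{a,b\}$ has letter counts $(2,1)$ or $(1,2)$, replaces that subword via $aab\leftrightarrow abb$, $aba\leftrightarrow bba$, $baa\leftrightarrow bab$ (other letters unchanged); $\bar\sigma_i$ is defined similarly via $aab\leftrightarrow bab$, $aba\leftrightarrow abb$, $baa\leftrightarrow bba$; $r_{(01\to11)}$ (resp. $r_{(10\to11)}$), applicable when the subword on $\{0,1\}$ is $01$ (resp. $10$), replaces the $0$ by $1$; $R_a$ deletes all letters $a$. For standard $\mathcal T$ of degree $n$ with $\mathcal T_{\{1,2\}}=12$, $\overset{*}{\mathbb B}{}_2^{(0)}\mathcal T=R_{n-1}\sigma_{n-2}\cdots\sigma_1r_{(01\to11)}\tau_{ -1}\mathcal T$; for $\mathcal T_{\{1,2\}}=21$, $\overset{*}{\mathbb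 B}{}_2^{(1)}\mathcal T=(\overset{*}{\mathbb B}{}_2^{(0)}\mathcal T^t)^t$. -}

module Defs where

open import Data.Nat using (ℕ; zero; suc; _+_; _∸_; _≤_; _<_; _≥_; _⊔_; _≡ᵇ_)
open import Data.Nat.Properties using (_≟_)
open import Data.Bool using (Bool; true; false; _∨_; not; if_then_else_)
open import Data.Nat.ListAction using (sum)
open import Data.List using (List; []; _∷_; _++_; map; concat; reverse; length; upTo; filterᵇ; foldr; take; drop)
open import Data.List.Properties using (≡-dec)
open import Data.List.Relation.Unary.All using (All)
open import Data.List.Relation.Unary.Linked using (Linked)
open import Data.List.Relation.Binary.Permutation.Propositional using (_↭_)
open import Data.Maybe using (Maybe; just; nothing; _>>=_)
open import Data.Product using (_×_; _,_)
open import Data.Unit using (⊤)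
open import Data.Empty using (⊥)
open import Relation.Nullary using (yes; no)
open import Relation.Binary.PropositionalEquality using (_≡_)

Word : Set
Word = List ℕ

-- A tableau (λ , w): shape λ = (λ₁ , λ₂ , …) listed from the bottom row up
-- (French convention), and reading word w (top row first, left to right).
record Tableau : Set where
  constructor tab
  field
    shape : List ℕ
    word  : Word
open Tableau public

degree : Tableau → ℕ
degree T = sum (shape T)

chunks : List ℕ → Word → List Word
chunks [] w = []
chunks (k ∷ ks) w = take k w ∷ chunks ks (drop k w)

-- Rows of the tableau, bottom row first.  The reading word is
-- row_top ++ … ++ row_bottom, so we chunk along the reversed shape.
rows : Tableau → List Word
rows T = reverse (chunks (reverse (shape T)) (word T))

fromRows : List Word → Tableau
fromRows rs = tab (map length rs) (concat (reverse rs))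

IsPartition : List ℕ → Set
IsPartition λ′ = Linked _≥_ λ′ × All (0 <_) λ′

-- entries of the row above (second argument) lie over entries of the
-- row below and are strictly larger
ColLt : Word → Word → Set
ColLt _ [] = ⊤
ColLt [] (_ ∷ _) = ⊥
ColLt (x ∷ xs) (y ∷ ys) = (x < y) × ColLt xs ys

IsSemiStandard : Tableau → Set
IsSemiStandard T =
  IsPartition (shape T) ×
  length (word T) ≡ sum (shape T) ×
  All (Linked _≤_) (rows T) ×
  Linked ColLt (rows T)

IsStandard : Tableau → Set
IsStandard T = IsSemiStandard T × (word T ↭ map suc (upTo (degree T)))

inPair : ℕ → ℕ → ℕ → Bool
inPair a b x = (x ≡ᵇ a) ∨ (x ≡ᵇ b)

subword₂ : ℕ → ℕ → Word → Word
subword₂ a b = filterᵇ (inPair a b)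

replaceSub : (ℕ → Bool) → Word → Word → Word
replaceSub p [] ys = []
replaceSub p (x ∷ xs) ys with p x | ys
... | false | _ = x ∷ replaceSub p xs ys
... | true | [] = x ∷ replaceSub p xs []
... | true | y ∷ ys′ = y ∷ replaceSub p xs ys′

lookupPat : List (Word × Word) → Word → Maybe Word
lookupPat [] s = nothing
lookupPat ((u , v) ∷ ps) s with ≡-dec _≟_ u s
... | yes _ = just v
... | no _ = lookupPat ps s

rewriteOn : ℕ → ℕ → List (Word × Word) → Word → Maybe Word
rewriteOn a b tbl w with lookupPat tbl (subword₂ a b w)
... | nothing = nothing
... | just s′ = just (replaceSub (inPair a b) w s′)

both : List (Word × Word) → List (Word × Word)
both ps = ps ++ map (λ { (u , v) → (v , u) }) ps

σ : ℕ → Word → Maybe Word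
σ i = rewriteOn a b (both ( ((a ∷ a ∷ b ∷ []) , (a ∷ b ∷ b ∷ []))
                          ∷ ((a ∷ b ∷ a ∷ []) , (b ∷ b ∷ a ∷ []))
                          ∷ ((b ∷ a ∷ a ∷ []) , (b ∷ a ∷ b ∷ [])) ∷ []))
  where a = i ; b = suc i

σ̄ : ℕ → Word → Maybe Word
σ̄ i = rewriteOn a b (both ( ((a ∷ a ∷ b ∷ []) , (b ∷ a ∷ b ∷ []))
                          ∷ ((a ∷ b ∷ a ∷ []) , (a ∷ b ∷ b ∷ []))
                          ∷ ((b ∷ a ∷ a ∷ []) , (b ∷ b ∷ a ∷ [])) ∷ []))
  where a = i ; b = suc i

r01→11 : Word → Maybe Word
r01→11 = rewriteOn 0 1 (((0 ∷ 1 ∷ []) , (1 ∷ 1 ∷ [])) ∷ [])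

r10→11 : Word → Maybe Word
r10→11 = rewriteOn 0 1 (((1 ∷ 0 ∷ []) , (1 ∷ 1 ∷ [])) ∷ [])

-- τ_{-1}: subtract 1 from every letter (only applied to standard
-- tableaux, whose letters are ≥ 1, so truncated subtraction is exact)
τ₋₁ : Word → Word
τ₋₁ = map (_∸ 1)

onWord : (Word → Maybe Word) → Tableau → Maybe Tableau
onWord f T = f (word T) >>= λ w′ → just (tab (shape T) w′)

-- f_k ∘ ⋯ ∘ f_2 ∘ f_1  (f_1 applied first)
chain : (ℕ → Word → Maybe Word) → ℕ → Word → Maybe Word
chain f zero w = just w
chain f (suc k) w = chain f k w >>= f (suc k)

nonEmpty : Word → Bool
nonEmpty [] = false
nonEmpty (_ ∷ _) = true

R : ℕ → Tableau → Tableau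
R a T = fromRows (filterᵇ nonEmpty (map (filterᵇ (λ x → not (x ≡ᵇ a))) (rows T)))

lookupM : Word → ℕ → Maybe ℕ
lookupM [] _ = nothing
lookupM (x ∷ xs) zero = just x
lookupM (x ∷ xs) (suc j) = lookupM xs j

catMaybes : List (Maybe ℕ) → Word
catMaybes [] = []
catMaybes (nothing ∷ ms) = catMaybes ms
catMaybes (just x ∷ ms) = x ∷ catMaybes ms

column : List Word → ℕ → Word
column rs j = catMaybes (map (λ r → lookupM r j) rs)

transpose : Tableau → Tableau
transpose T = fromRows (map (column rs) (upTo (foldr (λ r m → length r ⊔ m) 0 rs)))
  where rs = rows T

B₂⁰ : Tableau → Maybe Tableau
B₂⁰ T = onWord (λ w → r01→11 (τ₋₁ w) >>= chain σ (n ∸ 2)) T >>= λ U → just (R (n ∸ 1) U)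
  where n = degree T

B₂¹ : Tableau → Maybe Tableau
B₂¹ T = B₂⁰ (transpose T) >>= λ U → just (transpose U)

B₂¹-bar : Tableau → Maybe Tableau
B₂¹-bar T = onWord (λ w → r10→11 (τ₋₁ w) >>= chain σ̄ (n ∸ 2)) T >>= λ U → just (R (n ∸ 1) U)
  where n = degree T

-- Both sides are computed by relabelling the cells of 𝒯. After τ₋₁, the r-step and σ̄₁, …, σ̄ᵢ₋₁
-- on the reading word w of 𝒯, resp. σ₁, …, σᵢ₋₁ on the reading word wᵗ of 𝒯ᵗ, the two words are
-- h(w) and h(wᵗ) for one relabelling h of the labels of 𝒯: the letter i sits on two cells p, q in
-- different rows that are corners of the cells labelled at most i + 1, and the letter i + 1 on the
-- cell labelled i + 2. None of these three cells lies strictly south-west of another, so 𝒯ᵗ reads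
-- them in the reverse order of 𝒯; as σᵢ acts on a reversed subword just like σ̄ᵢ, both steps raise
-- the same cell to i + 1. Finally R_{n−1} removes the two corners; the remaining cells are
-- down-closed, and restricting to a down-closed set of cells commutes with transposition.

module Submission where

open import Defs
open import Data.Bool using (Bool; true; false; T; T?; not; if_then_else_)
open import Data.Bool.Properties using (T-≡; T-∨; ∨-zeroʳ)
open import Data.Empty using (⊥; ⊥-elim)
open import Data.List using (List; []; _∷_; _++_; map; concat; reverse; length; upTo; applyUpTo; filterᵇ; foldr; take; drop)
open import Data.List.Properties
  using (≡-dec; unfold-reverse; reverse-map; map-++; ++-identityʳ; concat-++; reverse-involutive;
         take-map; drop-map; take++drop≡id; length-drop; length-++)
open import Data.List.Membership.Propositional using (_∈_)
open import Data.List.Membership.Propositional.Properties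
  using (∈-map⁺; ∈-map⁻; ∈-++⁺ˡ; ∈-++⁺ʳ; ∈-++⁻; ∈-filter⁺; ∈-filter⁻; ∈-upTo⁺; ∈-upTo⁻)
open import Data.List.Membership.Propositional.Properties.WithK using (unique∧set⇒bag)
open import Data.List.Relation.Binary.BagAndSetEquality using (∼bag⇒↭)
open import Data.List.Relation.Binary.Permutation.Propositional using (↭-sym; ↭⇒↭ₛ)
open import Data.List.Relation.Binary.Permutation.Propositional.Properties using (↭-reverse; ∈-resp-↭; ↭-length)
open import Data.List.Relation.Binary.Subset.Propositional using (_⊆_)
open import Data.List.Relation.Unary.All as All using (All; []; _∷_)
import Data.List.Relation.Unary.All.Properties as Allₚ
open import Data.List.Relation.Unary.AllPairs as AllPairs using (AllPairs; []; _∷_)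
import Data.List.Relation.Unary.AllPairs.Properties as AllPairsₚ
open import Data.List.Relation.Unary.Any using (here; there)
import Data.List.Relation.Unary.Any.Properties as Anyₚ
open import Data.List.Relation.Unary.Linked as Linked using (Linked)
import Data.List.Relation.Unary.Unique.Propositional.Properties as Uniqueₚ
open import Data.Maybe using (Maybe; just; nothing; _>>=_)
import Data.Maybe as Maybe
open import Data.Maybe.Properties using (just-injective)
open import Data.Nat using (ℕ; zero; suc; _+_; _∸_; _≤_; _<_; _⊔_; _≡ᵇ_; z≤n; s≤s)
open import Data.Nat.Properties
open import Data.Nat.ListAction using (sum)
open import Data.Nat.ListAction.Properties using (sum-↭)
open import Data.Product as Product using (∃; ∃₂; ∃-syntax; _×_; _,_; proj₁; proj₂)
open import Data.Sum as Sum using (_⊎_; inj₁; inj₂)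
open import Function using (_∘_; flip)
open import Function.Bundles using (Equivalence; mk⇔)
open import Relation.Binary.Definitions using (tri<; tri≈; tri>)
open import Relation.Binary.PropositionalEquality
open import Relation.Nullary using (¬_; yes; no)
open import Data.List.Relation.Binary.Permutation.Setoid.Properties (setoid ℕ) using (Unique-resp-↭)

private variable
  A B : Set

T⇒≡true : ∀ {b} → T b → b ≡ true
T⇒≡true = Equivalence.to T-≡

≡true⇒T : ∀ {b} → b ≡ true → T b
≡true⇒T = Equivalence.from T-≡

_≢ᵇ_ : ℕ → ℕ → Bool
m ≢ᵇ n = not (m ≡ᵇ n)

≢ᵇ⇒≢ : ∀ {x a} → (x ≢ᵇ a) ≡ true → x ≢ a
≢ᵇ⇒≢ {x} kept refl rewrite T⇒≡true (≡⇒≡ᵇ x x refl) with () ← kept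

≢⇒≢ᵇ : ∀ {x a} → x ≢ a → (x ≢ᵇ a) ≡ true
≢⇒≢ᵇ {x} {a} x≢a with x ≡ᵇ a in e
... | true  = ⊥-elim (x≢a (≡ᵇ⇒≡ x a (≡true⇒T e)))
... | false = refl

infixl 5 _!?_
_!?_ : List A → ℕ → Maybe A
[]       !? _     = nothing
(x ∷ xs) !? zero  = just x
(x ∷ xs) !? suc i = xs !? i

lookupM≗!? : ∀ (w : Word) i → lookupM w i ≡ w !? i
lookupM≗!? []      i       = refl
lookupM≗!? (x ∷ w) zero    = refl
lookupM≗!? (x ∷ w) (suc i) = lookupM≗!? w i

!?-map : ∀ (f : A → B) xs i → map f xs !? i ≡ Maybe.map f (xs !? i)
!?-map f []       i       = refl
!?-map f (x ∷ xs) zero    = refl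
!?-map f (x ∷ xs) (suc i) = !?-map f xs i

!?-just⇒< : ∀ (xs : List A) {i x} → xs !? i ≡ just x → i < length xs
!?-just⇒< (y ∷ xs) {zero}  _ = s≤s z≤n
!?-just⇒< (y ∷ xs) {suc i} e = s≤s (!?-just⇒< xs e)

<⇒!?-just : ∀ (xs : List A) {i} → i < length xs → ∃ λ x → xs !? i ≡ just x
<⇒!?-just (y ∷ xs) {zero}  _         = y , refl
<⇒!?-just (y ∷ xs) {suc i} (s≤s i<) = <⇒!?-just xs i<

!?-applyUpTo : ∀ (f : ℕ → A) {n i} → i < n → applyUpTo f n !? i ≡ just (f i)
!?-applyUpTo f {suc n} {zero}  _         = refl
!?-applyUpTo f {suc n} {suc i} (s≤s i<n) = !?-applyUpTo (λ k → f (suc k)) i<n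

!?-applyUpTo-≥ : ∀ (f : ℕ → A) {n i} → n ≤ i → applyUpTo f n !? i ≡ nothing
!?-applyUpTo-≥ f {zero}              _         = refl
!?-applyUpTo-≥ f {suc n} {suc i} (s≤s n≤i) = !?-applyUpTo-≥ (λ k → f (suc k)) n≤i

!?-ext : ∀ (xs ys : List A) → (∀ i → xs !? i ≡ ys !? i) → xs ≡ ys
!?-ext []       []       _  = refl
!?-ext []       (y ∷ ys) eq with eq 0
... | ()
!?-ext (x ∷ xs) []       eq with eq 0
... | ()
!?-ext (x ∷ xs) (y ∷ ys) eq with eq 0
... | refl = cong (x ∷_) (!?-ext xs ys (λ i → eq (suc i)))

keepIf : (A → Bool) → A → Maybe A
keepIf p x = if p x then just x else nothing

keepIf-just⁻ : ∀ (P : A → Bool) (m : Maybe A) {x} → (m >>= keepIf P) ≡ just x → m ≡ just x × P x ≡ true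
keepIf-just⁻ P (just v) e with P v in pv
keepIf-just⁻ P (just v) refl | true = refl , pv

keepIf-just⁺ : ∀ (P : A → Bool) {m : Maybe A} {x} → m ≡ just x → P x ≡ true → (m >>= keepIf P) ≡ just x
keepIf-just⁺ P refl px rewrite px = refl

Maybe-map-just⁻ : ∀ (f : A → B) {m v} → Maybe.map f m ≡ just v → ∃ λ x → m ≡ just x × v ≡ f x
Maybe-map-just⁻ f {just x} refl = x , refl , refl

PrefixClosed : (A → Bool) → List A → Set
PrefixClosed p xs = ∀ {i j x} → j ≤ i → xs !? i ≡ just x → p x ≡ true →
                    ∃ λ y → xs !? j ≡ just y × p y ≡ true

private
  nothingKeptAfterReject : ∀ (p : A → Bool) {x} xs → PrefixClosed p (x ∷ xs) → p x ≡ false →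
                           ∀ i → (xs !? i >>= keepIf p) ≡ nothing
  nothingKeptAfterReject p xs pc px i with xs !? i in e
  ... | nothing = refl
  ... | just y with p y in py
  ...   | false = refl
  ...   | true with pc {suc i} z≤n e py
  ...     | _ , refl , px′ with () ← trans (sym px′) px

filterᵇ-!? : ∀ (p : A → Bool) xs → PrefixClosed p xs → ∀ i → filterᵇ p xs !? i ≡ (xs !? i >>= keepIf p)
filterᵇ-!? p []       _  i = refl
filterᵇ-!? p (x ∷ xs) pc i with p x in px
... | true with i
...   | zero  rewrite px = refl
...   | suc i = filterᵇ-!? p xs (λ j≤i → pc (s≤s j≤i)) i
filterᵇ-!? p (x ∷ xs) pc i | false = trans (filterᵇ-!? p xs (λ j≤i → pc (s≤s j≤i)) i) (bothNothing i)
  where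
  bothNothing : ∀ i → (xs !? i >>= keepIf p) ≡ ((x ∷ xs) !? i >>= keepIf p)
  bothNothing zero    rewrite px = nothingKeptAfterReject p xs pc px 0
  bothNothing (suc i) = trans (nothingKeptAfterReject p xs pc px (suc i)) (sym (nothingKeptAfterReject p xs pc px i))

AllPairs-map-∈ : ∀ {R : A → A → Set} {S : B → B → Set} (f : A → B) {xs} →
                 (∀ {u v} → u ∈ xs → v ∈ xs → R u v → S (f u) (f v)) → AllPairs R xs → AllPairs S (map f xs)
AllPairs-map-∈ f {x ∷ xs} imp (rx ∷ rxs) =
  Allₚ.map⁺ (All.tabulate (λ v∈ → imp (here refl) (there v∈) (All.lookup rx v∈))) ∷
  AllPairs-map-∈ f (λ u∈ v∈ → imp (there u∈) (there v∈)) rxs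
AllPairs-map-∈ f {[]} _ [] = []

AllPairs-reverse : ∀ {R : A → A → Set} {xs} → AllPairs R xs → AllPairs (flip R) (reverse xs)
AllPairs-reverse [] = []
AllPairs-reverse {xs = x ∷ xs} (rx ∷ rxs) rewrite unfold-reverse x xs =
  AllPairsₚ.++⁺ (AllPairs-reverse rxs) ([] ∷ []) (All.tabulate (λ v∈ → All.lookup rx (Anyₚ.reverse⁻ v∈) ∷ []))

unique-map-injective : ∀ (f : A → B) {xs x y} → AllPairs _≢_ (map f xs) → x ∈ xs → y ∈ xs → f x ≡ f y → x ≡ y
unique-map-injective f {_ ∷ _} _          (here refl) (here refl) _ = refl
unique-map-injective f {_ ∷ _} (fx∉ ∷ _)  (here refl) (there y∈)  e = ⊥-elim (All.lookup fx∉ (∈-map⁺ f y∈) e)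
unique-map-injective f {_ ∷ _} (fy∉ ∷ _)  (there x∈)  (here refl) e = ⊥-elim (All.lookup fy∉ (∈-map⁺ f x∈) (sym e))
unique-map-injective f {_ ∷ _} (_ ∷ uniq) (there x∈)  (there y∈)  e = unique-map-injective f uniq x∈ y∈ e

sorted-unique : ∀ {R : A → A → Set} {xs ys} → (∀ {x y} → x ∈ xs → y ∈ xs → R x y → R y x → ⊥) →
                AllPairs R xs → AllPairs R ys → xs ⊆ ys → ys ⊆ xs → xs ≡ ys
sorted-unique-tails : ∀ {R : A → A → Set} {x xs ys} →
                      (∀ {u v} → u ∈ x ∷ xs → v ∈ x ∷ xs → R u v → R v u → ⊥) →
                      All (R x) xs → All (R x) ys → AllPairs R xs → AllPairs R ys →
                      x ∷ xs ⊆ x ∷ ys → x ∷ ys ⊆ x ∷ xs → xs ≡ ys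

sorted-unique {xs = []}     {[]}     _    _          _          _   _   = refl
sorted-unique {xs = []}     {_ ∷ _}  _    _          _          _   ys⊆ with () ← ys⊆ (here refl)
sorted-unique {xs = _ ∷ _}  {[]}     _    _          _          xs⊆ _   with () ← xs⊆ (here refl)
sorted-unique {xs = x ∷ xs} {y ∷ ys} asym (rx ∷ rxs) (ry ∷ rys) xs⊆ ys⊆ with xs⊆ (here refl) | ys⊆ (here refl)
... | there x∈ys | there y∈xs = ⊥-elim (asym (here refl) (there y∈xs) (All.lookup rx y∈xs) (All.lookup ry x∈ys))
... | here refl  | _          = cong (x ∷_) (sorted-unique-tails asym rx ry rxs rys xs⊆ ys⊆)
... | there _    | here refl  = cong (x ∷_) (sorted-unique-tails asym rx ry rxs rys xs⊆ ys⊆)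

sorted-unique-tails {R = R} {x} asym rx ry rxs rys xs⊆ ys⊆ =
  sorted-unique (λ u∈ v∈ → asym (there u∈) (there v∈)) rxs rys
    (λ u∈ → dropHead (xs⊆ (there u∈)) (λ { refl → irrefl (All.lookup rx u∈) }))
    (λ u∈ → dropHead (ys⊆ (there u∈)) (λ { refl → irrefl (All.lookup ry u∈) }))
  where
  irrefl : R x x → ⊥
  irrefl r = asym (here refl) (here refl) r r
  dropHead : ∀ {u zs} → u ∈ x ∷ zs → u ≢ x → u ∈ zs
  dropHead (here u≡x) u≢x = ⊥-elim (u≢x u≡x)
  dropHead (there u∈) _   = u∈

-- Diagrams given by their rows, bottom row first

entry : List Word → ℕ → ℕ → Maybe ℕ
entry X r c = X !? r >>= λ row → row !? c

At : List Word → ℕ → ℕ → ℕ → Set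
At X ℓ r c = entry X r c ≡ just ℓ

entry-just⁻ : ∀ X {r c v} → entry X r c ≡ just v → ∃ λ row → X !? r ≡ just row × row !? c ≡ just v
entry-just⁻ X {r} e with X !? r
... | just row = row , refl , e

entry-row : ∀ X {r row} c → X !? r ≡ just row → entry X r c ≡ row !? c
entry-row X c e rewrite e = refl

entry-map : ∀ (h : ℕ → ℕ) X r c → entry (map (map h) X) r c ≡ Maybe.map h (entry X r c)
entry-map h []        r       c = refl
entry-map h (row ∷ X) zero    c = !?-map h row c
entry-map h (row ∷ X) (suc r) c = entry-map h X r c

entry-left : ∀ X {r c c′ x} → c′ ≤ c → entry X r c ≡ just x → ∃ λ y → entry X r c′ ≡ just y
entry-left X c′≤c e with entry-just⁻ X e
... | row , er , ec rewrite er = <⇒!?-just row (≤-<-trans c′≤c (!?-just⇒< row ec))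

IsDiagram : List Word → Set
IsDiagram X = ∀ {r c x} → entry X (suc r) c ≡ just x → ∃ λ y → entry X r c ≡ just y

IsDiagram-below : ∀ X → IsDiagram X → ∀ {r r′ c x} → r′ ≤ r → entry X r c ≡ just x →
                  ∃ λ y → entry X r′ c ≡ just y
IsDiagram-below X sh {r′ = r′} {c} {x} r′≤r e with m≤n⇒∃[o]m+o≡n r′≤r
... | d , refl = climb d (subst (λ k → entry X k c ≡ just x) (+-comm r′ d) e)
  where
  climb : ∀ d {x} → entry X (d + r′) c ≡ just x → ∃ λ y → entry X r′ c ≡ just y
  climb zero    e = _ , e
  climb (suc d) e = climb d (proj₂ (sh e))

IsDiagram-southwest : ∀ X → IsDiagram X → ∀ {r c r′ c′ x} → r′ ≤ r → c′ ≤ c → entry X r c ≡ just x →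
                  ∃ λ y → entry X r′ c′ ≡ just y
IsDiagram-southwest X sh r′≤r c′≤c e = entry-left X c′≤c (proj₂ (IsDiagram-below X sh r′≤r e))

NoEmptyRow : List Word → Set
NoEmptyRow Y = ∀ {r} → Y !? r ≢ just []

rows-ext : ∀ Y Y′ → NoEmptyRow Y → NoEmptyRow Y′ → (∀ r c → entry Y r c ≡ entry Y′ r c) → Y ≡ Y′
rows-ext []             []         _  _  _  = refl
rows-ext []             ([] ∷ Y′)  _  ne _  = ⊥-elim (ne {0} refl)
rows-ext []             ((_ ∷ _) ∷ Y′) _ _ eq with eq 0 0
... | ()
rows-ext ([] ∷ Y)       Y′         ne _  _  = ⊥-elim (ne {0} refl)
rows-ext ((_ ∷ _) ∷ Y)  []         _  _  eq with eq 0 0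
... | ()
rows-ext ((x ∷ row) ∷ Y) (row′ ∷ Y′) ne ne′ eq =
  cong₂ _∷_ (!?-ext (x ∷ row) row′ (eq 0))
            (rows-ext Y Y′ (λ {r} → ne {suc r}) (λ {r} → ne′ {suc r}) (λ r → eq (suc r)))

width : List Word → ℕ
width = foldr (λ r m → length r ⊔ m) 0

cols : List Word → List Word
cols X = map (column X) (upTo (width X))

entry-width : ∀ X {r c x} → entry X r c ≡ just x → c < width X
entry-width (row ∷ X) {zero}  e = ≤-trans (!?-just⇒< row e) (m≤m⊔n (length row) (width X))
entry-width (row ∷ X) {suc r} e = ≤-trans (entry-width X e) (m≤n⊔m (length row) (width X))

width-entry : ∀ X {c} → c < width X → ∃₂ λ r x → entry X r c ≡ just x
width-entry (row ∷ X) {c} c< with ≤-total (length row) (width X)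
... | inj₁ row≤ with r , x , e ← width-entry X (subst (c <_) (m≤n⇒m⊔n≡n row≤) c<) = suc r , x , e
... | inj₂ row≥ with x , e ← <⇒!?-just row (subst (c <_) (m≥n⇒m⊔n≡m row≥) c<) = zero , x , e

private
  columnMissing : ∀ row X {j} → IsDiagram (row ∷ X) → row !? j ≡ nothing → ∀ i → entry X i j ≡ nothing
  columnMissing row X {j} sh e i with entry X i j in e′
  ... | nothing = refl
  ... | just x with () ← trans (sym e) (proj₂ (IsDiagram-below (row ∷ X) sh {suc i} z≤n e′))

column-!? : ∀ X → IsDiagram X → ∀ j i → column X j !? i ≡ entry X i j
column-!? []        _  j i = refl
column-!? (row ∷ X) sh j i with lookupM row j | lookupM≗!? row j
... | just x  | e with i
...   | zero  = e
...   | suc i = column-!? X (λ {r} → sh {suc r}) j i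
column-!? (row ∷ X) sh j zero    | nothing | e =
  trans (column-!? X (λ {r} → sh {suc r}) j 0) (trans (columnMissing row X sh (sym e) 0) e)
column-!? (row ∷ X) sh j (suc i) | nothing | e =
  trans (column-!? X (λ {r} → sh {suc r}) j (suc i))
        (trans (columnMissing row X sh (sym e) (suc i)) (sym (columnMissing row X sh (sym e) i)))

cols-!? : ∀ X {c} → c < width X → cols X !? c ≡ just (column X c)
cols-!? X {c} c< =
  trans (!?-map (column X) (upTo (width X)) c) (cong (Maybe.map (column X)) (!?-applyUpTo (λ k → k) c<))

cols-!?-≥ : ∀ X {c} → width X ≤ c → cols X !? c ≡ nothing
cols-!?-≥ X {c} w≤ =
  trans (!?-map (column X) (upTo (width X)) c) (cong (Maybe.map (column X)) (!?-applyUpTo-≥ (λ k → k) w≤))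

Transposed : List Word → List Word → Set
Transposed Y Z = ∀ r c → entry Y c r ≡ entry Z r c

entry-cols : ∀ X → IsDiagram X → Transposed (cols X) X
entry-cols X sh r c with c <? width X
... | yes c< rewrite cols-!? X c< = column-!? X sh c r
... | no c≮ rewrite cols-!?-≥ X (≮⇒≥ c≮) with entry X r c in e
...   | nothing = refl
...   | just x  = ⊥-elim (c≮ (entry-width X e))

NoEmptyRow-cols : ∀ X → IsDiagram X → NoEmptyRow (cols X)
NoEmptyRow-cols X sh {c} e with c <? width X
... | no c≮ with () ← trans (sym (cols-!?-≥ X (≮⇒≥ c≮))) e
... | yes c< with r , x , ex ← width-entry X c<
  with () ← trans (sym (trans (column-!? X sh c r) ex)) (cong (_!? r) (just-injective (trans (sym (cols-!? X c<)) e)))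

restrict : (ℕ → Bool) → List Word → List Word
restrict P Y = filterᵇ nonEmpty (map (filterᵇ P) Y)

DownClosed : (ℕ → Bool) → List Word → Set
DownClosed P Y = ∀ {r c v r′ c′} → entry Y r c ≡ just v → P v ≡ true → r′ ≤ r → c′ ≤ c →
                 ∃ λ v′ → entry Y r′ c′ ≡ just v′ × P v′ ≡ true

private
  rejectedRow : ∀ (P : ℕ → Bool) row {c v} → nonEmpty (filterᵇ P row) ≡ false → row !? c ≡ just v → P v ≡ false
  rejectedRow P (x ∷ row) {c} ne e with P x in px
  rejectedRow P (x ∷ row) {zero}  ne refl | false = px
  rejectedRow P (x ∷ row) {suc c} ne e    | false = rejectedRow P row ne e

  nothingKept : ∀ P row Y → DownClosed P (row ∷ Y) → nonEmpty (filterᵇ P row) ≡ false →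
                ∀ r c → (entry (row ∷ Y) r c >>= keepIf P) ≡ nothing
  nothingKept P row Y dc ne r c with entry (row ∷ Y) r c in e
  ... | nothing = refl
  ... | just v with P v in pv
  ...   | false = refl
  ...   | true with dc {r} {c} {r′ = 0} {c′ = c} e pv z≤n ≤-refl
  ...     | v′ , e′ , pv′ with () ← trans (sym pv′) (rejectedRow P row ne e′)

entry-restrict : ∀ P Y → DownClosed P Y → ∀ r c → entry (restrict P Y) r c ≡ (entry Y r c >>= keepIf P)
entry-restrict P []        _  r c = refl
entry-restrict P (row ∷ Y) dc r c with nonEmpty (filterᵇ P row) in ne
... | true with r
...   | zero  = filterᵇ-!? P row rowClosed c
  where
  rowClosed : PrefixClosed P row
  rowClosed {i} j≤i e pv = dc {0} {i} e pv ≤-refl j≤i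
...   | suc r = entry-restrict P Y (λ {r} {c} e pv r′≤ c′≤ → dc {suc r} {c} e pv (s≤s r′≤) c′≤) r c
entry-restrict P (row ∷ Y) dc r c | false =
  trans (entry-restrict P Y (λ {r} {c} e pv r′≤ c′≤ → dc {suc r} {c} e pv (s≤s r′≤) c′≤) r c)
        (trans (nothingKept P row Y dc ne (suc r) c) (sym (nothingKept P row Y dc ne r c)))

NoEmptyRow-restrict : ∀ P Y → NoEmptyRow (restrict P Y)
NoEmptyRow-restrict P Y = nonEmptyRows (map (filterᵇ P) Y)
  where
  nonEmptyRows : ∀ Ys → NoEmptyRow (filterᵇ nonEmpty Ys)
  nonEmptyRows ([] ∷ Ys)              e = nonEmptyRows Ys e
  nonEmptyRows ((_ ∷ _) ∷ Ys) {suc r} e = nonEmptyRows Ys e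

IsDiagram-restrict : ∀ P Y → DownClosed P Y → IsDiagram (restrict P Y)
IsDiagram-restrict P Y dc {r} {c} e with keepIf-just⁻ P (entry Y (suc r) c) (trans (sym (entry-restrict P Y dc (suc r) c)) e)
... | e′ , px with v , ev , pv ← dc e′ px (n≤1+n r) ≤-refl =
  v , trans (entry-restrict P Y dc r c) (keepIf-just⁺ P ev pv)

Transposed-map : ∀ (h : ℕ → ℕ) Y Z → Transposed Y Z → Transposed (map (map h) Y) (map (map h) Z)
Transposed-map h Y Z t r c rewrite entry-map h Y c r | entry-map h Z r c = cong (Maybe.map h) (t r c)

DownClosed-transposed : ∀ P Y Z → Transposed Y Z → DownClosed P Z → DownClosed P Y
DownClosed-transposed P Y Z t dc {c} {r} {v} {c′} {r′} e pv c′≤ r′≤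
  rewrite t r c | t r′ c′ = dc e pv r′≤ c′≤

cols-restrict : ∀ P Y Z → Transposed Y Z → DownClosed P Z → cols (restrict P Y) ≡ restrict P Z
cols-restrict P Y Z t dc =
  rows-ext _ _ (NoEmptyRow-cols W diagramW) (NoEmptyRow-restrict P Z) sameEntries
  where
  W = restrict P Y
  dcY = DownClosed-transposed P Y Z t dc
  diagramW = IsDiagram-restrict P Y dcY
  sameEntries : ∀ r c → entry (cols W) r c ≡ entry (restrict P Z) r c
  sameEntries r c = begin
    entry (cols W) r c           ≡⟨ entry-cols W diagramW c r ⟩
    entry W c r                  ≡⟨ entry-restrict P Y dcY c r ⟩
    (entry Y c r >>= keepIf P)   ≡⟨ cong (_>>= keepIf P) (t r c) ⟩
    (entry Z r c >>= keepIf P)   ≡⟨ entry-restrict P Z dc r c ⟨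
    entry (restrict P Z) r c     ∎
    where open ≡-Reasoning

-- Reading words

readingWord : List Word → Word
readingWord X = concat (reverse X)

chunks-concat : ∀ (Zs : List Word) → chunks (map length Zs) (concat Zs) ≡ Zs
chunks-concat []       = refl
chunks-concat (z ∷ Zs) = cong₂ _∷_ (take-length z (concat Zs))
                                   (trans (cong (chunks (map length Zs)) (drop-length z (concat Zs))) (chunks-concat Zs))
  where
  take-length : ∀ (z w : Word) → take (length z) (z ++ w) ≡ z
  take-length []      w = refl
  take-length (x ∷ z) w = cong (x ∷_) (take-length z w)
  drop-length : ∀ (z w : Word) → drop (length z) (z ++ w) ≡ w
  drop-length []      w = refl
  drop-length (x ∷ z) w = drop-length z w

rows-fromRows : ∀ Ys → rows (fromRows Ys) ≡ Ys
rows-fromRows Ys = begin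
  reverse (chunks (reverse (map length Ys)) (readingWord Ys))
    ≡⟨ cong (λ ks → reverse (chunks ks (readingWord Ys))) (reverse-map length Ys) ⟨
  reverse (chunks (map length (reverse Ys)) (readingWord Ys))
    ≡⟨ cong reverse (chunks-concat (reverse Ys)) ⟩
  reverse (reverse Ys)
    ≡⟨ reverse-involutive Ys ⟩
  Ys ∎
  where open ≡-Reasoning

rows-map : ∀ (h : ℕ → ℕ) sh w → rows (tab sh (map h w)) ≡ map (map h) (rows (tab sh w))
rows-map h sh w = trans (cong reverse (chunks-map (reverse sh) w)) (sym (reverse-map (map h) (chunks (reverse sh) w)))
  where
  chunks-map : ∀ ks w → chunks ks (map h w) ≡ map (map h) (chunks ks w)
  chunks-map []       w = refl
  chunks-map (k ∷ ks) w = cong₂ _∷_ (take-map k w) (trans (cong (chunks ks) (drop-map k w)) (chunks-map ks (drop k w)))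

sum-reverse : ∀ (xs : List ℕ) → sum (reverse xs) ≡ sum xs
sum-reverse xs = sum-↭ (↭-reverse xs)

readingWord-rows : ∀ T → length (word T) ≡ degree T → readingWord (rows T) ≡ word T
readingWord-rows (tab sh w) len =
  trans (cong concat (reverse-involutive (chunks (reverse sh) w)))
        (concat-chunks (reverse sh) w (≤-reflexive (trans len (sym (sum-reverse sh)))))
  where
  concat-chunks : ∀ ks (w : Word) → length w ≤ sum ks → concat (chunks ks w) ≡ w
  concat-chunks []       []      _  = refl
  concat-chunks (k ∷ ks) w       le = trans (cong (take k w ++_) (concat-chunks ks (drop k w) le′)) (take++drop≡id k w)
    where
    le′ : length (drop k w) ≤ sum ks
    le′ = subst (_≤ sum ks) (sym (length-drop k w)) (m≤n+o⇒m∸n≤o (length w) k le)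

degree-fromRows : ∀ Ys → degree (fromRows Ys) ≡ length (readingWord Ys)
degree-fromRows Ys = begin
  sum (map length Ys)           ≡⟨ sum-reverse (map length Ys) ⟨
  sum (reverse (map length Ys)) ≡⟨ cong sum (reverse-map length Ys) ⟨
  sum (map length (reverse Ys)) ≡⟨ length-concat (reverse Ys) ⟨
  length (readingWord Ys)       ∎
  where
  open ≡-Reasoning
  length-concat : ∀ (Zs : List Word) → length (concat Zs) ≡ sum (map length Zs)
  length-concat []       = refl
  length-concat (z ∷ Zs) = trans (length-++ z) (cong (length z +_) (length-concat Zs))

ReadBefore : ℕ → ℕ → ℕ → ℕ → Set
ReadBefore r c r′ c′ = r′ < r ⊎ (r ≡ r′ × c < c′)

ReadBefore-irrefl : ∀ {r c} → ¬ ReadBefore r c r c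
ReadBefore-irrefl (inj₁ r<r)       = <-irrefl refl r<r
ReadBefore-irrefl (inj₂ (_ , c<c)) = <-irrefl refl c<c

ReadBefore-asym : ∀ {r c r′ c′} → ReadBefore r c r′ c′ → ¬ ReadBefore r′ c′ r c
ReadBefore-asym (inj₁ r′<r)          (inj₁ r<r′)          = <-asym r′<r r<r′
ReadBefore-asym (inj₁ r′<r)          (inj₂ (refl , _))    = <-irrefl refl r′<r
ReadBefore-asym (inj₂ (refl , _))    (inj₁ r<r)           = <-irrefl refl r<r
ReadBefore-asym (inj₂ (_ , c<c′))    (inj₂ (_ , c′<c))    = <-asym c<c′ c′<c

ReadBefore-trans : ∀ {r c r′ c′ r″ c″} → ReadBefore r c r′ c′ → ReadBefore r′ c′ r″ c″ →
                   ReadBefore r c r″ c″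
ReadBefore-trans (inj₁ r′<r)       (inj₁ r″<r′)      = inj₁ (<-trans r″<r′ r′<r)
ReadBefore-trans (inj₁ r′<r)       (inj₂ (refl , _)) = inj₁ r′<r
ReadBefore-trans (inj₂ (refl , _)) (inj₁ r″<r)       = inj₁ r″<r
ReadBefore-trans (inj₂ (refl , c<c′)) (inj₂ (refl , c′<c″)) = inj₂ (refl , <-trans c<c′ c′<c″)

ReadBefore-total : ∀ r c r′ c′ → (r ≡ r′ → c ≢ c′) → ReadBefore r c r′ c′ ⊎ ReadBefore r′ c′ r c
ReadBefore-total r c r′ c′ distinct with <-cmp r r′
... | tri< r<r′ _ _ = inj₂ (inj₁ r<r′)
... | tri> _ _ r′<r = inj₁ (inj₁ r′<r)
... | tri≈ _ refl _ with <-cmp c c′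
...   | tri< c<c′ _ _  = inj₁ (inj₂ (refl , c<c′))
...   | tri≈ _ c≡c′ _  = ⊥-elim (distinct refl c≡c′)
...   | tri> _ _ c′<c  = inj₂ (inj₂ (refl , c′<c))

ReadBefore-row : ∀ {r c r′ c′} → ReadBefore r c r′ c′ → r′ ≤ r
ReadBefore-row (inj₁ r′<r)       = <⇒≤ r′<r
ReadBefore-row (inj₂ (refl , _)) = ≤-refl

ReadBefore-transpose : ∀ {r c r′ c′} → ReadBefore r c r′ c′ → ¬ (r′ < r × c′ < c) → ReadBefore c′ r′ c r
ReadBefore-transpose {c = c} {c′ = c′} (inj₁ r′<r) notSW with <-cmp c c′
... | tri< c<c′ _ _ = inj₁ c<c′
... | tri≈ _ refl _ = inj₂ (refl , r′<r)
... | tri> _ _ c′<c = ⊥-elim (notSW (r′<r , c′<c))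
ReadBefore-transpose (inj₂ (refl , c<c′)) _ = inj₁ c<c′

-- (label , row , column)
Cell : Set
Cell = ℕ × ℕ × ℕ

CellReadBefore : Cell → Cell → Set
CellReadBefore (_ , r , c) (_ , r′ , c′) = ReadBefore r c r′ c′

rowCells : ℕ → ℕ → Word → List Cell
rowCells r c []       = []
rowCells r c (x ∷ xs) = (x , r , c) ∷ rowCells r (suc c) xs

cells : ℕ → List Word → List Cell
cells r []        = []
cells r (row ∷ X) = cells (suc r) X ++ rowCells r 0 row

labels-cells : ∀ r X → map proj₁ (cells r X) ≡ readingWord X
labels-cells r []        = refl
labels-cells r (row ∷ X) = begin
  map proj₁ (cells (suc r) X ++ rowCells r 0 row)
    ≡⟨ map-++ proj₁ (cells (suc r) X) (rowCells r 0 row) ⟩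
  map proj₁ (cells (suc r) X) ++ map proj₁ (rowCells r 0 row)
    ≡⟨ cong₂ _++_ (labels-cells (suc r) X) (labels-rowCells 0 row) ⟩
  readingWord X ++ row
    ≡⟨ cong (readingWord X ++_) (++-identityʳ row) ⟨
  readingWord X ++ concat (row ∷ [])
    ≡⟨ concat-++ (reverse X) (row ∷ []) ⟩
  concat (reverse X ++ row ∷ [])
    ≡⟨ cong concat (unfold-reverse row X) ⟨
  readingWord (row ∷ X) ∎
  where
  open ≡-Reasoning
  labels-rowCells : ∀ c xs → map proj₁ (rowCells r c xs) ≡ xs
  labels-rowCells c []       = refl
  labels-rowCells c (x ∷ xs) = cong (x ∷_) (labels-rowCells (suc c) xs)

∈-rowCells⁻ : ∀ r c xs {ℓ r′ c′} → (ℓ , r′ , c′) ∈ rowCells r c xs →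
              r′ ≡ r × ∃ λ d → c′ ≡ c + d × xs !? d ≡ just ℓ
∈-rowCells⁻ r c (x ∷ xs) (here refl) = refl , 0 , sym (+-identityʳ c) , refl
∈-rowCells⁻ r c (x ∷ xs) (there m) with r′≡r , d , refl , e ← ∈-rowCells⁻ r (suc c) xs m =
  r′≡r , suc d , sym (+-suc c d) , e

∈-rowCells⁺ : ∀ r c xs {ℓ} d → xs !? d ≡ just ℓ → (ℓ , r , c + d) ∈ rowCells r c xs
∈-rowCells⁺ r c (x ∷ xs) zero    refl rewrite +-identityʳ c = here refl
∈-rowCells⁺ r c (x ∷ xs) (suc d) e    rewrite +-suc c d     = there (∈-rowCells⁺ r (suc c) xs d e)

∈-cells⁻ : ∀ r X {ℓ r′ c′} → (ℓ , r′ , c′) ∈ cells r X → ∃ λ d → r′ ≡ r + d × At X ℓ d c′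
∈-cells⁻ r (row ∷ X) m with ∈-++⁻ (cells (suc r) X) m
... | inj₁ m′ with d , refl , e ← ∈-cells⁻ (suc r) X m′ = suc d , sym (+-suc r d) , e
... | inj₂ m′ with refl , d , refl , e ← ∈-rowCells⁻ r 0 row m′ = 0 , sym (+-identityʳ r) , e

∈-cells⁺ : ∀ r X {ℓ} d c → At X ℓ d c → (ℓ , r + d , c) ∈ cells r X
∈-cells⁺ r (row ∷ X) zero    c e rewrite +-identityʳ r = ∈-++⁺ʳ (cells (suc r) X) (∈-rowCells⁺ r 0 row c e)
∈-cells⁺ r (row ∷ X) (suc d) c e rewrite +-suc r d     = ∈-++⁺ˡ (∈-cells⁺ (suc r) X d c e)

cells-sorted : ∀ r X → AllPairs CellReadBefore (cells r X)
cells-sorted r []        = []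
cells-sorted r (row ∷ X) =
  AllPairsₚ.++⁺ (cells-sorted (suc r) X) (rowCells-sorted 0 row) (All.tabulate higherFirst)
  where
  rowCells-sorted : ∀ c xs → AllPairs CellReadBefore (rowCells r c xs)
  rowCells-sorted c []       = []
  rowCells-sorted c (x ∷ xs) = All.tabulate leftFirst ∷ rowCells-sorted (suc c) xs
    where
    leftFirst : ∀ {v} → v ∈ rowCells r (suc c) xs → CellReadBefore (x , r , c) v
    leftFirst {_ , _ , _} m with refl , d , refl , _ ← ∈-rowCells⁻ r (suc c) xs m = inj₂ (refl , m≤m+n (suc c) d)
  higherFirst : ∀ {u} → u ∈ cells (suc r) X → All (CellReadBefore u) (rowCells r 0 row)
  higherFirst {ℓ , _ , c} m with d , refl , _ ← ∈-cells⁻ (suc r) X m = All.tabulate below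
    where
    below : ∀ {v} → v ∈ rowCells r 0 row → CellReadBefore (ℓ , suc (r + d) , c) v
    below {_ , _ , _} m′ with refl , _ ← ∈-rowCells⁻ r 0 row m′ = inj₁ (m≤m+n (suc r) d)

UniquePositions : List Word → Set
UniquePositions X = ∀ {ℓ r c r′ c′} → At X ℓ r c → At X ℓ r′ c′ → r ≡ r′ × c ≡ c′

LabelReadBefore : List Word → ℕ → ℕ → Set
LabelReadBefore X ℓ m = ∀ {r c r′ c′} → At X ℓ r c → At X m r′ c′ → ReadBefore r c r′ c′

∈-readingWord⁻ : ∀ X {ℓ} → ℓ ∈ readingWord X → ∃₂ λ r c → At X ℓ r c
∈-readingWord⁻ X m with (_ , r , c) , m′ , refl ← ∈-map⁻ proj₁ (subst (_ ∈_) (sym (labels-cells 0 X)) m)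
  with _ , refl , e ← ∈-cells⁻ 0 X m′ = r , c , e

∈-readingWord⁺ : ∀ X {ℓ r c} → At X ℓ r c → ℓ ∈ readingWord X
∈-readingWord⁺ X {r = r} {c} e = subst (_ ∈_) (labels-cells 0 X) (∈-map⁺ proj₁ (∈-cells⁺ 0 X r c e))

private
  cell-At : ∀ X {ℓ r c} → (ℓ , r , c) ∈ cells 0 X → At X ℓ r c
  cell-At X m with _ , refl , e ← ∈-cells⁻ 0 X m = e

readingWord-sorted : ∀ X → UniquePositions X → AllPairs (LabelReadBefore X) (readingWord X)
readingWord-sorted X uniq = subst (AllPairs (LabelReadBefore X)) (labels-cells 0 X)
  (AllPairs-map-∈ proj₁ sameCells (cells-sorted 0 X))
  where
  sameCells : ∀ {u v} → u ∈ cells 0 X → v ∈ cells 0 X → CellReadBefore u v → LabelReadBefore X (proj₁ u) (proj₁ v)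
  sameCells {_ , _ , _} {_ , _ , _} u∈ v∈ before eu ev
    with refl , refl ← uniq (cell-At X u∈) eu | refl , refl ← uniq (cell-At X v∈) ev = before

readingWord-distinct : ∀ X → UniquePositions X → AllPairs _≢_ (readingWord X)
readingWord-distinct X uniq = subst (AllPairs _≢_) (labels-cells 0 X)
  (AllPairs-map-∈ proj₁ distinctLabels (cells-sorted 0 X))
  where
  distinctLabels : ∀ {u v} → u ∈ cells 0 X → v ∈ cells 0 X → CellReadBefore u v → proj₁ u ≢ proj₁ v
  distinctLabels {_ , _ , _} {_ , _ , _} u∈ v∈ before refl
    with refl , refl ← uniq (cell-At X u∈) (cell-At X v∈) = ReadBefore-irrefl before

LabelReadBefore-at : ∀ X → UniquePositions X → ∀ {ℓ m r c r′ c′} → At X ℓ r c → At X m r′ c′ →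
                     ReadBefore r c r′ c′ → LabelReadBefore X ℓ m
LabelReadBefore-at X uniq eℓ em before eℓ′ em′
  with refl , refl ← uniq eℓ eℓ′ | refl , refl ← uniq em em′ = before

filterᵇ-readingWord : ∀ X → UniquePositions X → (Q : ℕ → Bool) {L : List ℕ} → AllPairs (LabelReadBefore X) L →
                      (∀ {x} → x ∈ readingWord X → Q x ≡ true → x ∈ L) →
                      (∀ {x} → x ∈ L → x ∈ readingWord X × Q x ≡ true) →
                      filterᵇ Q (readingWord X) ≡ L
filterᵇ-readingWord X uniq Q sorted complete sound =
  sorted-unique asym (AllPairsₚ.filter⁺ (T? ∘ Q) (readingWord-sorted X uniq)) sorted
    (λ m → let m′ , q = ∈-filter⁻ (T? ∘ Q) m in complete m′ (T⇒≡true q))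
    (λ m → let m′ , q = sound m in ∈-filter⁺ (T? ∘ Q) m′ (≡true⇒T q))
  where
  asym : ∀ {x y} → x ∈ filterᵇ Q (readingWord X) → y ∈ filterᵇ Q (readingWord X) →
         LabelReadBefore X x y → LabelReadBefore X y x → ⊥
  asym x∈ y∈ xy yx
    with _ , _ , ex ← ∈-readingWord⁻ X (proj₁ (∈-filter⁻ (T? ∘ Q) x∈))
       | _ , _ , ey ← ∈-readingWord⁻ X (proj₁ (∈-filter⁻ (T? ∘ Q) y∈)) = ReadBefore-asym (xy ex ey) (yx ey ex)

ReadOppositely : List Word → ℕ → ℕ → Set
ReadOppositely X ℓ m = LabelReadBefore X ℓ m × LabelReadBefore (cols X) m ℓ

module _ (X : List Word) (sh : IsDiagram X) (uniq : UniquePositions X) where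

  At-cols⁻ : ∀ {ℓ r c} → At (cols X) ℓ c r → At X ℓ r c
  At-cols⁻ {r = r} {c} e = trans (sym (entry-cols X sh r c)) e

  At-cols⁺ : ∀ {ℓ r c} → At X ℓ r c → At (cols X) ℓ c r
  At-cols⁺ {r = r} {c} e = trans (entry-cols X sh r c) e

  UniquePositions-cols : UniquePositions (cols X)
  UniquePositions-cols e e′ with refl , refl ← uniq (At-cols⁻ e) (At-cols⁻ e′) = refl , refl

  ∈-readingWord-cols⁺ : ∀ {ℓ} → ℓ ∈ readingWord X → ℓ ∈ readingWord (cols X)
  ∈-readingWord-cols⁺ m with _ , _ , e ← ∈-readingWord⁻ X m = ∈-readingWord⁺ (cols X) (At-cols⁺ e)

  ∈-readingWord-cols⁻ : ∀ {ℓ} → ℓ ∈ readingWord (cols X) → ℓ ∈ readingWord X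
  ∈-readingWord-cols⁻ m with _ , _ , e ← ∈-readingWord⁻ (cols X) m = ∈-readingWord⁺ X (At-cols⁻ e)

  length-readingWord-cols : length (readingWord (cols X)) ≡ length (readingWord X)
  length-readingWord-cols = ↭-length (∼bag⇒↭ (unique∧set⇒bag
    (readingWord-distinct (cols X) UniquePositions-cols) (readingWord-distinct X uniq)
    (mk⇔ ∈-readingWord-cols⁻ ∈-readingWord-cols⁺)))

  readOppositely : ∀ {ℓ m r c r′ c′} → At X ℓ r c → At X m r′ c′ → ReadBefore r c r′ c′ →
                   ¬ (r′ < r × c′ < c) → ReadOppositely X ℓ m
  readOppositely eℓ em before notSW = LabelReadBefore-at X uniq eℓ em before , reversed
    where
    reversed : LabelReadBefore (cols X) _ _
    reversed em′ eℓ′ with refl , refl ← uniq em (At-cols⁻ em′) | refl , refl ← uniq eℓ (At-cols⁻ eℓ′) =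
      ReadBefore-transpose before notSW

  subwords-transpose : (Q : ℕ → Bool) {L : List ℕ} → AllPairs (ReadOppositely X) L →
                       (∀ {x} → x ∈ readingWord X → Q x ≡ true → x ∈ L) →
                       (∀ {x} → x ∈ L → x ∈ readingWord X × Q x ≡ true) →
                       filterᵇ Q (readingWord X) ≡ L × filterᵇ Q (readingWord (cols X)) ≡ reverse L
  subwords-transpose Q opp complete sound =
    filterᵇ-readingWord X uniq Q (AllPairs.map proj₁ opp) complete sound ,
    filterᵇ-readingWord (cols X) UniquePositions-cols Q (AllPairs-reverse (AllPairs.map proj₂ opp))
      (λ m q → Anyₚ.reverse⁺ (complete (∈-readingWord-cols⁻ m) q))
      (λ m → let m′ , q = sound (Anyₚ.reverse⁻ m) in ∈-readingWord-cols⁺ m′ , q)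

update : (ℕ → ℕ) → ℕ → ℕ → ℕ → ℕ
update h k v ℓ = if ℓ ≡ᵇ k then v else h ℓ

update-same : ∀ h k v → update h k v k ≡ v
update-same h k v rewrite T⇒≡true (≡⇒≡ᵇ k k refl) = refl

update-other : ∀ h {k} v {ℓ} → ℓ ≢ k → update h k v ℓ ≡ h ℓ
update-other h {k} v {ℓ} ℓ≢k with ℓ ≡ᵇ k in e
... | true  = ⊥-elim (ℓ≢k (≡ᵇ⇒≡ ℓ k (≡true⇒T e)))
... | false = refl

filterᵇ-map : ∀ (p : B → Bool) (h : A → B) w → filterᵇ p (map h w) ≡ map h (filterᵇ (p ∘ h) w)
filterᵇ-map p h []      = refl
filterᵇ-map p h (x ∷ w) with p (h x)
... | true  = cong (h x ∷_) (filterᵇ-map p h w)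
... | false = filterᵇ-map p h w

replaceSub-map : ∀ (p : ℕ → Bool) (h h′ : ℕ → ℕ) → (∀ ℓ → p (h ℓ) ≡ false → h′ ℓ ≡ h ℓ) →
                 ∀ w → replaceSub p (map h w) (map h′ (filterᵇ (p ∘ h) w)) ≡ map h′ w
replaceSub-map p h h′ off []      = refl
replaceSub-map p h h′ off (x ∷ w) with p (h x) in e
... | true  = cong (h′ x ∷_) (replaceSub-map p h h′ off w)
... | false = cong₂ _∷_ (sym (off x e)) (replaceSub-map p h h′ off w)

rewriteOn-map : ∀ a b tbl (h h′ : ℕ → ℕ) w {L} → filterᵇ (inPair a b ∘ h) w ≡ L →
                lookupPat tbl (map h L) ≡ just (map h′ L) →
                (∀ ℓ → inPair a b (h ℓ) ≡ false → h′ ℓ ≡ h ℓ) →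
                rewriteOn a b tbl (map h w) ≡ just (map h′ w)
rewriteOn-map a b tbl h h′ w refl rule off
  rewrite filterᵇ-map (inPair a b) h w | rule = cong just (replaceSub-map (inPair a b) h h′ off w)

lookupPat-here : ∀ u {v ps} → lookupPat ((u , v) ∷ ps) u ≡ just v
lookupPat-here u with ≡-dec _≟_ u u
... | yes _   = refl
... | no  u≢u = ⊥-elim (u≢u refl)

lookupPat-there : ∀ u {v ps} s → u ≢ s → lookupPat ((u , v) ∷ ps) s ≡ lookupPat ps s
lookupPat-there u s u≢s with ≡-dec _≟_ u s
... | yes u≡s = ⊥-elim (u≢s u≡s)
... | no  _   = refl

-- Standard tableaux

record IsStandardRows (X : List Word) (n : ℕ) : Set where
  field
    isDiagram : IsDiagram X
    monotone  : ∀ {ℓ r c ℓ′ r′ c′} → At X ℓ r c → At X ℓ′ r′ c′ → r ≤ r′ → c ≤ c′ →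
                ℓ ≤ ℓ′
    unique    : UniquePositions X
    bounded   : ∀ {ℓ r c} → At X ℓ r c → 1 ≤ ℓ × ℓ ≤ n
    occurs    : ∀ {ℓ} → 1 ≤ ℓ → ℓ ≤ n → ∃₂ λ r c → At X ℓ r c

columnStep : ∀ X → Linked ColLt X → ∀ {r c y} → entry X (suc r) c ≡ just y →
             ∃ λ x → entry X r c ≡ just x × x < y
columnStep (row ∷ row′ ∷ X) (below Linked.∷ _) {zero}  = belowEntry row row′ below
  where
  belowEntry : ∀ row row′ → ColLt row row′ → ∀ {c y} → row′ !? c ≡ just y →
               ∃ λ x → row !? c ≡ just x × x < y
  belowEntry (x ∷ row) (y ∷ row′) (x<y , _)  {zero}  refl = x , refl , x<y
  belowEntry (x ∷ row) (y ∷ row′) (_ , rest) {suc c} e    = belowEntry row row′ rest e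
columnStep (row ∷ row′ ∷ X) (_ Linked.∷ linked) {suc r} = columnStep (row′ ∷ X) linked

row-monotone : ∀ (row : Word) → Linked _≤_ row → ∀ {i j x y} → i ≤ j →
               row !? i ≡ just x → row !? j ≡ just y → x ≤ y
row-monotone (a ∷ row)     _                 {zero}  {zero}  _         refl refl = ≤-refl
row-monotone (a ∷ [])      _                 {zero}  {suc j} _         refl ()
row-monotone (a ∷ b ∷ row) (a≤b Linked.∷ l) {zero}  {suc j} _         refl e    =
  ≤-trans a≤b (row-monotone (b ∷ row) l {zero} {j} z≤n refl e)
row-monotone (a ∷ b ∷ row) (_ Linked.∷ l)   {suc i} {suc j} (s≤s i≤j) e    e′   = row-monotone (b ∷ row) l i≤j e e′

column-monotone : ∀ X → Linked ColLt X → ∀ d {r c x y} → entry X r c ≡ just x → entry X (d + r) c ≡ just y → x ≤ y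
column-monotone X linked zero    e e′ with refl ← trans (sym e) e′ = ≤-refl
column-monotone X linked (suc d) e e′ with z , ez , z<y ← columnStep X linked e′ =
  ≤-trans (column-monotone X linked d e ez) (<⇒≤ z<y)

isStandardRows : ∀ T → IsStandard T → IsStandardRows (rows T) (degree T)
isStandardRows T ((_ , len , rowsSorted , linked) , perm) = record
  { isDiagram = isDiagram
  ; monotone  = monotone
  ; unique    = unique
  ; bounded   = λ e → bounded (∈-labels (∈-readingWord⁺ X e))
  ; occurs    = occurs
  }
  where
  X = rows T
  n = degree T
  ∈-labels : ∀ {ℓ} → ℓ ∈ readingWord X → ℓ ∈ map suc (upTo n)
  ∈-labels m = ∈-resp-↭ perm (subst (_ ∈_) (readingWord-rows T len) m)
  isDiagram : IsDiagram X
  isDiagram e = let x , ex , _ = columnStep X linked e in x , ex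
  monotone : ∀ {ℓ r c ℓ′ r′ c′} → At X ℓ r c → At X ℓ′ r′ c′ → r ≤ r′ → c ≤ c′ →
             ℓ ≤ ℓ′
  monotone {r = r} {c} {ℓ′} {r′} {c′} e e′ r≤r′ c≤c′
    with z , ez ← IsDiagram-below X isDiagram r≤r′ e′
       | row , erow , ec ← entry-just⁻ X e
       | d , refl ← m≤n⇒∃[o]m+o≡n r≤r′ =
    ≤-trans (row-monotone row (All.lookup rowsSorted (!?⇒∈ X erow)) c≤c′ ec (trans (sym (entry-row X c′ erow)) ez))
            (column-monotone X linked d {r} ez (subst (λ k → entry X k c′ ≡ just ℓ′) (+-comm r d) e′))
    where
    !?⇒∈ : ∀ (Y : List Word) {i y} → Y !? i ≡ just y → y ∈ Y
    !?⇒∈ (y ∷ Y) {zero}  refl = here refl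
    !?⇒∈ (_ ∷ Y) {suc i} e    = there (!?⇒∈ Y e)
  distinctCellLabels : AllPairs _≢_ (map proj₁ (cells 0 X))
  distinctCellLabels = subst (AllPairs _≢_) (sym (trans (labels-cells 0 X) (readingWord-rows T len)))
    (Unique-resp-↭ (↭⇒↭ₛ (↭-sym perm)) (Uniqueₚ.map⁺ suc-injective (Uniqueₚ.upTo⁺ n)))
  unique : UniquePositions X
  unique {r = r} {c} {r′} {c′} e e′
    with refl ← unique-map-injective proj₁ distinctCellLabels (∈-cells⁺ 0 X r c e) (∈-cells⁺ 0 X r′ c′ e′) refl =
    refl , refl
  bounded : ∀ {ℓ} → ℓ ∈ map suc (upTo n) → 1 ≤ ℓ × ℓ ≤ n
  bounded m with k , k∈ , refl ← ∈-map⁻ suc m = s≤s z≤n , ∈-upTo⁻ k∈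
  occurs : ∀ {ℓ} → 1 ≤ ℓ → ℓ ≤ n → ∃₂ λ r c → At X ℓ r c
  occurs {suc k} _ ℓ≤n = ∈-readingWord⁻ X
    (subst (_ ∈_) (sym (readingWord-rows T len)) (∈-resp-↭ (↭-sym perm) (∈-map⁺ suc (∈-upTo⁺ ℓ≤n))))

module _ {X n} (std : IsStandardRows X n) where
  open IsStandardRows std

  one-at-origin : 1 ≤ n → At X 1 0 0
  one-at-origin 1≤n with r , c , e ← occurs ≤-refl 1≤n with ℓ , e₀ ← IsDiagram-southwest X isDiagram z≤n z≤n e
    with refl ← ≤-antisym (monotone e₀ e z≤n z≤n) (proj₁ (bounded e₀)) = e₀

  later-not-southwest : ∀ {u v ru cu rv cv} → At X u ru cu → At X v rv cv → u < v → ¬ (rv ≤ ru × cv ≤ cu)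
  later-not-southwest eu ev u<v (rv≤ru , cv≤cu) = <⇒≱ u<v (monotone ev eu rv≤ru cv≤cu)

module _ (i : ℕ) where
  private
    aab aba baa abb bba bab : Word
    aab = i ∷ i ∷ suc i ∷ []
    aba = i ∷ suc i ∷ i ∷ []
    baa = suc i ∷ i ∷ i ∷ []
    abb = i ∷ suc i ∷ suc i ∷ []
    bba = suc i ∷ suc i ∷ i ∷ []
    bab = suc i ∷ i ∷ suc i ∷ []

  σ̄-table : List (Word × Word)
  σ̄-table = (aab , bab) ∷ (aba , abb) ∷ (baa , bba) ∷ (bab , aab) ∷ (abb , aba) ∷ (bba , baa) ∷ []

  σ-table : List (Word × Word)
  σ-table = (aab , abb) ∷ (aba , bba) ∷ (baa , bab) ∷ (abb , aab) ∷ (bba , aba) ∷ (bab , baa) ∷ []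

  σ̄-aab : lookupPat σ̄-table aab ≡ just bab
  σ̄-aab = lookupPat-here aab

  σ̄-aba : lookupPat σ̄-table aba ≡ just abb
  σ̄-aba = trans (lookupPat-there aab aba (λ ())) (lookupPat-here aba)

  σ̄-baa : lookupPat σ̄-table baa ≡ just bba
  σ̄-baa = trans (lookupPat-there aab baa (λ ())) (trans (lookupPat-there aba baa (λ ())) (lookupPat-here baa))

  σ-aab : lookupPat σ-table aab ≡ just abb
  σ-aab = lookupPat-here aab

  σ-aba : lookupPat σ-table aba ≡ just bba
  σ-aba = trans (lookupPat-there aab aba (λ ())) (lookupPat-here aba)

  σ-baa : lookupPat σ-table baa ≡ just bab
  σ-baa = trans (lookupPat-there aab baa (λ ())) (trans (lookupPat-there aba baa (λ ())) (lookupPat-here baa))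

lookupPat-map₃ : ∀ tbl (h h′ : ℕ → ℕ) {x y z a₁ a₂ a₃ b₁ b₂ b₃} →
                 h x ≡ a₁ → h y ≡ a₂ → h z ≡ a₃ → h′ x ≡ b₁ → h′ y ≡ b₂ → h′ z ≡ b₃ →
                 lookupPat tbl (a₁ ∷ a₂ ∷ a₃ ∷ []) ≡ just (b₁ ∷ b₂ ∷ b₃ ∷ []) →
                 lookupPat tbl (map h (x ∷ y ∷ z ∷ [])) ≡ just (map h′ (x ∷ y ∷ z ∷ []))
lookupPat-map₃ tbl h h′ refl refl refl refl refl refl rule = rule

σ̄-map : ∀ i (h h′ : ℕ → ℕ) w {L} → filterᵇ (inPair i (suc i) ∘ h) w ≡ L →
        lookupPat (σ̄-table i) (map h L) ≡ just (map h′ L) →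
        (∀ ℓ → inPair i (suc i) (h ℓ) ≡ false → h′ ℓ ≡ h ℓ) → σ̄ i (map h w) ≡ just (map h′ w)
σ̄-map i = rewriteOn-map i (suc i) (σ̄-table i)

σ-map : ∀ i (h h′ : ℕ → ℕ) w {L} → filterᵇ (inPair i (suc i) ∘ h) w ≡ L →
        lookupPat (σ-table i) (map h L) ≡ just (map h′ L) →
        (∀ ℓ → inPair i (suc i) (h ℓ) ≡ false → h′ ℓ ≡ h ℓ) → σ i (map h w) ≡ just (map h′ w)
σ-map i = rewriteOn-map i (suc i) (σ-table i)

inPair-true : ∀ a b x → inPair a b x ≡ true → x ≡ a ⊎ x ≡ b
inPair-true a b x e = Sum.map (≡ᵇ⇒≡ x a) (≡ᵇ⇒≡ x b) (Equivalence.to T-∨ (≡true⇒T e))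

inPair-left : ∀ a b → inPair a b a ≡ true
inPair-left a b rewrite T⇒≡true (≡⇒≡ᵇ a a refl) = refl

inPair-right : ∀ a b → inPair a b b ≡ true
inPair-right a b rewrite T⇒≡true (≡⇒≡ᵇ b b refl) = ∨-zeroʳ (b ≡ᵇ a)

inPair-bounds : ∀ {i v} → inPair i (suc i) v ≡ true → i ≤ v × v ≤ suc i
inPair-bounds {i} {v} e with inPair-true i (suc i) v e
... | inj₁ refl = ≤-refl , n≤1+n i
... | inj₂ refl = n≤1+n i , ≤-refl

module Stages {X : List Word} {n : ℕ} (std : IsStandardRows X n) where
  open IsStandardRows std

  wT : Word
  wT = readingWord X

  wS : Word
  wS = readingWord (cols X)

  -- The state before σ̄ᵢ resp. σᵢ, both words being relabelled by h: the letter i sits on the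
  -- corners p and q of the cells labelled at most i + 1, and labels above i + 1 are only shifted.
  record Stage (i : ℕ) (h : ℕ → ℕ) (p q : ℕ) : Set where
    field
      untouched  : ∀ {ℓ} → suc (suc i) ≤ ℓ → h ℓ ≡ ℓ ∸ 1
      h-p        : h p ≡ i
      h-q        : h q ≡ i
      p≢q        : p ≢ q
      1≤p        : 1 ≤ p
      1≤q        : 1 ≤ q
      p≤         : p ≤ suc i
      q≤         : q ≤ suc i
      h-rest     : ∀ {ℓ} → 1 ≤ ℓ → ℓ ≤ suc i → ℓ ≢ p → ℓ ≢ q → h ℓ < i
      corners    : ∀ {ℓ r c ℓ′ r′ c′} → At X ℓ r c → ℓ ≤ suc i → ℓ ≢ p → ℓ ≢ q →
                   At X ℓ′ r′ c′ → r′ ≤ r → c′ ≤ c → ℓ′ ≢ p × ℓ′ ≢ q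
      rowsDiffer : ∀ {r c r′ c′} → At X p r c → At X q r′ c′ → r ≢ r′

  Stage-swap : ∀ {i h p q} → Stage i h p q → Stage i h q p
  Stage-swap st = record
    { untouched  = untouched
    ; h-p        = h-q
    ; h-q        = h-p
    ; p≢q        = p≢q ∘ sym
    ; 1≤p        = 1≤q
    ; 1≤q        = 1≤p
    ; p≤         = q≤
    ; q≤         = p≤
    ; h-rest     = λ 1≤ℓ ℓ≤ ℓ≢q ℓ≢p → h-rest 1≤ℓ ℓ≤ ℓ≢p ℓ≢q
    ; corners    = λ eℓ ℓ≤ ℓ≢q ℓ≢p eℓ′ r′≤ c′≤ →
                     Product.swap (corners eℓ ℓ≤ ℓ≢p ℓ≢q eℓ′ r′≤ c′≤)
    ; rowsDiffer = λ eq ep r≡ → rowsDiffer ep eq (sym r≡)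
    }
    where open Stage st

  trio : ℕ → ℕ → ℕ → List ℕ
  trio i p q = p ∷ q ∷ suc (suc i) ∷ []

  module _ {i h p q} (st : Stage i h p q) where
    open Stage st

    h-next : h (suc (suc i)) ≡ suc i
    h-next = untouched ≤-refl

    trio-bounds : ∀ {x} → x ∈ trio i p q → 1 ≤ x × x ≤ suc (suc i)
    trio-bounds (here refl)                 = 1≤p , m≤n⇒m≤1+n p≤
    trio-bounds (there (here refl))         = 1≤q , m≤n⇒m≤1+n q≤
    trio-bounds (there (there (here refl))) = s≤s z≤n , ≤-refl

    inPair-trio : ∀ {x} → x ∈ trio i p q → inPair i (suc i) (h x) ≡ true
    inPair-trio (here refl)                 rewrite h-p    = inPair-left i (suc i)
    inPair-trio (there (here refl))         rewrite h-q    = inPair-left i (suc i)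
    inPair-trio (there (there (here refl))) rewrite h-next = inPair-right i (suc i)

    trio-complete : ∀ {x} → 1 ≤ x → inPair i (suc i) (h x) ≡ true → x ∈ trio i p q
    trio-complete {x} 1≤x hx with x ≟ p | x ≟ q | <-cmp x (suc (suc i))
    ... | yes refl | _        | _             = here refl
    ... | no _     | yes refl | _             = there (here refl)
    ... | no _     | no _     | tri≈ _ refl _ = there (there (here refl))
    ... | no x≢p   | no x≢q   | tri< x<C _ _  =
      ⊥-elim (<⇒≱ (h-rest 1≤x (≤-pred x<C) x≢p x≢q) (proj₁ (inPair-bounds hx)))
    ... | no _     | no _     | tri> _ _ C<x  =
      ⊥-elim (<-irrefl refl (≤-trans C≤hx (proj₂ (inPair-bounds hx))))
      where
      C≤hx : suc (suc i) ≤ h x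
      C≤hx = subst (suc (suc i) ≤_) (sym (untouched (<⇒≤ C<x))) (∸-monoˡ-≤ 1 C<x)

    C≢ : ∀ {x} → x ≤ suc i → suc (suc i) ≢ x
    C≢ x≤ refl = <-irrefl refl x≤

    trio-At : suc (suc i) ≤ n → ∀ {x} → x ∈ trio i p q → ∃₂ λ r c → At X x r c
    trio-At C≤n x∈ = let 1≤x , x≤C = trio-bounds x∈ in occurs 1≤x (≤-trans x≤C C≤n)

    p-not-strictly-southwest : ∀ {rp cp v rv cv} → At X p rp cp → At X v rv cv → v ≤ suc (suc i) → ¬ (rp < rv × cp < cv)
    p-not-strictly-southwest {v = v} ep ev v≤C (rp<rv , cp<cv) with IsDiagram-below X isDiagram (<⇒≤ rp<rv) ev
    ... | ℓ , eℓ = proj₁ (corners eℓ ℓ≤ ℓ≢p ℓ≢q ep ≤-refl (<⇒≤ cp<cv)) refl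
      where
      ℓ≢v : ℓ ≢ v
      ℓ≢v refl = <-irrefl (proj₁ (unique eℓ ev)) rp<rv
      ℓ≤ : ℓ ≤ suc i
      ℓ≤ = ≤-pred (≤-trans (≤∧≢⇒< (monotone eℓ ev (<⇒≤ rp<rv) ≤-refl) ℓ≢v) v≤C)
      ℓ≢p : ℓ ≢ p
      ℓ≢p refl = <-irrefl (proj₂ (unique ep eℓ)) cp<cv
      ℓ≢q : ℓ ≢ q
      ℓ≢q refl = rowsDiffer ep eℓ refl

    Stage-next : (∀ {r c r′ c′} → At X p r c → At X q r′ c′ → r ≤ r′ → c ≤ c′ → ⊥) →
                 (∀ {r c r′ c′} → At X p r c → At X (suc (suc i)) r′ c′ → r ≢ r′) →
                 Stage (suc i) (update h p (suc i)) p (suc (suc i))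
    Stage-next p-not-below-q rows-pC = record
      { untouched  = λ C<ℓ → trans (update-other h (suc i) (far≢p C<ℓ)) (untouched (≤-trans (n≤1+n _) C<ℓ))
      ; h-p        = update-same h p (suc i)
      ; h-q        = trans (update-other h (suc i) (C≢ p≤)) h-next
      ; p≢q        = C≢ p≤ ∘ sym
      ; 1≤p        = 1≤p
      ; 1≤q        = s≤s z≤n
      ; p≤         = m≤n⇒m≤1+n p≤
      ; q≤         = ≤-refl
      ; h-rest     = rest
      ; corners    = corners′
      ; rowsDiffer = rows-pC
      }
      where
      far≢p : ∀ {ℓ} → suc (suc (suc i)) ≤ ℓ → ℓ ≢ p
      far≢p C<ℓ refl = <-irrefl refl (≤-trans (≤-trans (n≤1+n _) C<ℓ) p≤)
      rest : ∀ {ℓ} → 1 ≤ ℓ → ℓ ≤ suc (suc i) → ℓ ≢ p → ℓ ≢ suc (suc i) → update h p (suc i) ℓ < suc i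
      rest {ℓ} 1≤ℓ ℓ≤ ℓ≢p ℓ≢C rewrite update-other h (suc i) ℓ≢p with ℓ ≟ q
      ... | yes refl = ≤-reflexive (cong suc h-q)
      ... | no ℓ≢q   = m<n⇒m<1+n (h-rest 1≤ℓ (≤-pred (≤∧≢⇒< ℓ≤ ℓ≢C)) ℓ≢p ℓ≢q)
      corners′ : ∀ {ℓ r c ℓ′ r′ c′} → At X ℓ r c → ℓ ≤ suc (suc i) → ℓ ≢ p → ℓ ≢ suc (suc i) →
                 At X ℓ′ r′ c′ → r′ ≤ r → c′ ≤ c → ℓ′ ≢ p × ℓ′ ≢ suc (suc i)
      corners′ {ℓ} eℓ ℓ≤ ℓ≢p ℓ≢C eℓ′ r′≤ c′≤ =
        ℓ′≢p , C≢ (≤-trans (monotone eℓ′ eℓ r′≤ c′≤) ℓ≤i+1) ∘ sym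
        where
        ℓ≤i+1 : ℓ ≤ suc i
        ℓ≤i+1 = ≤-pred (≤∧≢⇒< ℓ≤ ℓ≢C)
        ℓ′≢p : _ ≢ p
        ℓ′≢p with ℓ ≟ q
        ... | yes refl = λ { refl → p-not-below-q eℓ′ eℓ r′≤ c′≤ }
        ... | no ℓ≢q   = proj₁ (corners eℓ ℓ≤i+1 ℓ≢p ℓ≢q eℓ′ r′≤ c′≤)

  module _ {i h p q} (st : Stage i h p q) where
    open Stage st

    trio-not-strictly-southwest : ∀ {u v ru cu rv cv} → u ∈ trio i p q → v ∈ trio i p q →
                                  At X u ru cu → At X v rv cv → ¬ (rv < ru × cv < cu)
    trio-not-strictly-southwest u∈ (here refl)         eu ev =
      p-not-strictly-southwest st ev eu (proj₂ (trio-bounds st u∈))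
    trio-not-strictly-southwest u∈ (there (here refl)) eu ev =
      p-not-strictly-southwest (Stage-swap st) ev eu (proj₂ (trio-bounds st u∈))
    trio-not-strictly-southwest (here refl)                 (there (there (here refl))) eu ev (rv<ru , cv<cu) =
      later-not-southwest std eu ev (s≤s p≤) (<⇒≤ rv<ru , <⇒≤ cv<cu)
    trio-not-strictly-southwest (there (here refl))         (there (there (here refl))) eu ev (rv<ru , cv<cu) =
      later-not-southwest std eu ev (s≤s q≤) (<⇒≤ rv<ru , <⇒≤ cv<cu)
    trio-not-strictly-southwest (there (there (here refl))) (there (there (here refl))) eu ev (rv<ru , _) =
      <-irrefl (sym (proj₁ (unique eu ev))) rv<ru

    trio-readOppositely : ∀ {u v ru cu rv cv} → u ∈ trio i p q → v ∈ trio i p q →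
                          At X u ru cu → At X v rv cv → ReadBefore ru cu rv cv → ReadOppositely X u v
    trio-readOppositely u∈ v∈ eu ev before =
      readOppositely X isDiagram unique eu ev before (trio-not-strictly-southwest u∈ v∈ eu ev)

  trio-subwords : ∀ {i h p q x y z rx cx ry cy rz cz} → Stage i h p q →
                  x ∈ trio i p q → y ∈ trio i p q → z ∈ trio i p q → trio i p q ⊆ x ∷ y ∷ z ∷ [] →
                  At X x rx cx → At X y ry cy → At X z rz cz → ReadBefore rx cx ry cy → ReadBefore ry cy rz cz →
                  filterᵇ (inPair i (suc i) ∘ h) wT ≡ x ∷ y ∷ z ∷ [] ×
                  filterᵇ (inPair i (suc i) ∘ h) wS ≡ z ∷ y ∷ x ∷ []
  trio-subwords {i} {h} st x∈ y∈ z∈ trio⊆ ex ey ez xy yz =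
    subwords-transpose X isDiagram unique (inPair i (suc i) ∘ h) ordered complete sound
    where
    ordered : AllPairs (ReadOppositely X) (_ ∷ _ ∷ _ ∷ [])
    ordered = ( trio-readOppositely st x∈ y∈ ex ey xy
              ∷ trio-readOppositely st x∈ z∈ ex ez (ReadBefore-trans xy yz) ∷ [])
            ∷ (trio-readOppositely st y∈ z∈ ey ez yz ∷ [])
            ∷ [] ∷ []
    complete : ∀ {v} → v ∈ wT → inPair i (suc i) (h v) ≡ true → v ∈ _ ∷ _ ∷ _ ∷ []
    complete m hv = trio⊆ (trio-complete st (proj₁ (bounded (proj₂ (proj₂ (∈-readingWord⁻ X m))))) hv)
    sound : ∀ {v} → v ∈ _ ∷ _ ∷ _ ∷ [] → v ∈ wT × inPair i (suc i) (h v) ≡ true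
    sound (here refl)                 = ∈-readingWord⁺ X ex , inPair-trio st x∈
    sound (there (here refl))         = ∈-readingWord⁺ X ey , inPair-trio st y∈
    sound (there (there (here refl))) = ∈-readingWord⁺ X ez , inPair-trio st z∈

  record NextStage (i : ℕ) (h : ℕ → ℕ) : Set where
    constructor nextStage
    field
      h′    : ℕ → ℕ
      p′ q′ : ℕ
      stage : Stage (suc i) h′ p′ q′
      onT   : σ̄ i (map h wT) ≡ just (map h′ wT)
      onS   : σ i (map h wS) ≡ just (map h′ wS)

  advance : ∀ {i h p q k p′ q′} {L Lᵗ : List ℕ} → Stage i h p q → k ∈ p ∷ q ∷ [] →
            Stage (suc i) (update h k (suc i)) p′ q′ →
            filterᵇ (inPair i (suc i) ∘ h) wT ≡ L × filterᵇ (inPair i (suc i) ∘ h) wS ≡ Lᵗ →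
            lookupPat (σ̄-table i) (map h L) ≡ just (map (update h k (suc i)) L) →
            lookupPat (σ-table i) (map h Lᵗ) ≡ just (map (update h k (suc i)) Lᵗ) →
            NextStage i h
  advance {i} {h} {p} {q} {k} st k∈ st′ (subT , subS) ruleT ruleS =
    nextStage _ _ _ st′ (σ̄-map i h h′ wT subT ruleT unchanged) (σ-map i h h′ wS subS ruleS unchanged)
    where
    h′ = update h k (suc i)
    pq⊆trio : p ∷ q ∷ [] ⊆ trio _ _ _
    pq⊆trio (here refl)         = here refl
    pq⊆trio (there (here refl)) = there (here refl)
    unchanged : ∀ ℓ → inPair i (suc i) (h ℓ) ≡ false → h′ ℓ ≡ h ℓ
    unchanged ℓ off with ℓ ≟ k
    ... | no ℓ≢k   = update-other h (suc i) ℓ≢k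
    ... | yes refl with () ← trans (sym (inPair-trio st (pq⊆trio k∈))) off

  ⊆-three : ∀ {a b c : ℕ} {L} → a ∈ L → b ∈ L → c ∈ L → a ∷ b ∷ c ∷ [] ⊆ L
  ⊆-three a∈ b∈ c∈ (here refl)                 = a∈
  ⊆-three a∈ b∈ c∈ (there (here refl))         = b∈
  ⊆-three a∈ b∈ c∈ (there (there (here refl))) = c∈

  module _ {i h p q rp cp rq cq rC cC} (st : Stage i h p q)
           (ep : At X p rp cp) (eq : At X q rq cq) (eC : At X (suc (suc i)) rC cC) where
    open Stage st

    private
      C = suc (suc i)

      p∈ : p ∈ trio i p q
      p∈ = here refl

      q∈ : q ∈ trio i p q
      q∈ = there (here refl)

      C∈ : C ∈ trio i p q
      C∈ = there (there (here refl))

      raiseP-p : update h p (suc i) p ≡ suc i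
      raiseP-p = update-same h p (suc i)

      raiseP-q : update h p (suc i) q ≡ i
      raiseP-q = trans (update-other h (suc i) (p≢q ∘ sym)) h-q

      raiseP-C : update h p (suc i) C ≡ suc i
      raiseP-C = trans (update-other h (suc i) (C≢ st p≤)) (h-next st)

      raiseQ-p : update h q (suc i) p ≡ i
      raiseQ-p = trans (update-other h (suc i) p≢q) h-p

      raiseQ-q : update h q (suc i) q ≡ suc i
      raiseQ-q = update-same h q (suc i)

      raiseQ-C : update h q (suc i) C ≡ suc i
      raiseQ-C = trans (update-other h (suc i) (C≢ st q≤)) (h-next st)

      p-not-below-q : ReadBefore rp cp rq cq →
                      ∀ {r c r′ c′} → At X p r c → At X q r′ c′ → r ≤ r′ → c ≤ c′ → ⊥
      p-not-below-q pq ep′ eq′ r≤r′ _ with refl , refl ← unique ep ep′ | refl , refl ← unique eq eq′ with pq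
      ... | inj₁ rq<rp       = <⇒≱ rq<rp r≤r′
      ... | inj₂ (rp≡rq , _) = rowsDiffer ep eq rp≡rq


      C-before-p⇒rows : ReadBefore rC cC rp cp → rp ≢ rC
      C-before-p⇒rows (inj₁ rp<rC)     rp≡rC = <-irrefl rp≡rC rp<rC
      C-before-p⇒rows (inj₂ (_ , cC<cp)) rp≡rC =
        later-not-southwest std ep eC (s≤s p≤) (≤-reflexive (sym rp≡rC) , <⇒≤ cC<cp)

      C-before-q⇒rows : ReadBefore rC cC rq cq → rq ≢ rC
      C-before-q⇒rows (inj₁ rq<rC)     rq≡rC = <-irrefl rq≡rC rq<rC
      C-before-q⇒rows (inj₂ (_ , cC<cq)) rq≡rC =
        later-not-southwest std eq eC (s≤s q≤) (≤-reflexive (sym rq≡rC) , <⇒≤ cC<cq)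

      p-before-C⇒left : ReadBefore rp cp rC cC → cp < cC
      p-before-C⇒left pC = ≰⇒> λ cC≤cp → later-not-southwest std ep eC (s≤s p≤) (ReadBefore-row pC , cC≤cp)

      p-before-C-before-q⇒q≰p : ReadBefore rp cp rC cC → ReadBefore rC cC rq cq → cq ≤ cp → ⊥
      p-before-C-before-q⇒q≰p pC (inj₁ rq<rC) cq≤cp =
        p-not-strictly-southwest (Stage-swap st) eq eC ≤-refl (rq<rC , ≤-<-trans cq≤cp (p-before-C⇒left pC))
      p-before-C-before-q⇒q≰p pC (inj₂ (_ , cC<cq)) cq≤cp = <-asym cC<cq (≤-<-trans cq≤cp (p-before-C⇒left pC))

    C-last : ReadBefore rp cp rq cq → ReadBefore rq cq rC cC → NextStage i h
    C-last pq qC =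
      advance st (here refl) (Stage-next st (p-not-below-q pq) rows-pC)
        (trio-subwords st p∈ q∈ C∈ (λ m → m) ep eq eC pq qC)
        (lookupPat-map₃ (σ̄-table i) h _ h-p h-q (h-next st) raiseP-p raiseP-q raiseP-C (σ̄-aab i))
        (lookupPat-map₃ (σ-table i) h _ (h-next st) h-q h-p raiseP-C raiseP-q raiseP-p (σ-baa i))
      where
      rows-pC : ∀ {r c r′ c′} → At X p r c → At X C r′ c′ → r ≢ r′
      rows-pC ep′ eC′ rp≡rC with refl , refl ← unique ep ep′ | refl , refl ← unique eC eC′ =
        rowsDiffer ep eq (≤-antisym (subst (_≤ rq) (sym rp≡rC) (ReadBefore-row qC)) (ReadBefore-row pq))

    C-first : ReadBefore rC cC rp cp → ReadBefore rp cp rq cq → NextStage i h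
    C-first Cp pq =
      advance st (here refl) (Stage-next st (p-not-below-q pq) rows-pC)
        (trio-subwords st C∈ p∈ q∈ (⊆-three (there (here refl)) (there (there (here refl))) (here refl)) eC ep eq Cp pq)
        (lookupPat-map₃ (σ̄-table i) h _ (h-next st) h-p h-q raiseP-C raiseP-p raiseP-q (σ̄-baa i))
        (lookupPat-map₃ (σ-table i) h _ h-q h-p (h-next st) raiseP-q raiseP-p raiseP-C (σ-aab i))
      where
      rows-pC : ∀ {r c r′ c′} → At X p r c → At X C r′ c′ → r ≢ r′
      rows-pC ep′ eC′ with refl , refl ← unique ep ep′ | refl , refl ← unique eC eC′ = C-before-p⇒rows Cp

    C-between : ReadBefore rp cp rC cC → ReadBefore rC cC rq cq → NextStage i h
    C-between pC Cq =
      advance st (there (here refl)) (Stage-next (Stage-swap st) q-not-below-p rows-qC)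
        (trio-subwords st p∈ C∈ q∈ (⊆-three (here refl) (there (there (here refl))) (there (here refl))) ep eC eq pC Cq)
        (lookupPat-map₃ (σ̄-table i) h _ h-p (h-next st) h-q raiseQ-p raiseQ-C raiseQ-q (σ̄-aba i))
        (lookupPat-map₃ (σ-table i) h _ h-q (h-next st) h-p raiseQ-q raiseQ-C raiseQ-p (σ-aba i))
      where
      q-not-below-p : ∀ {r c r′ c′} → At X q r c → At X p r′ c′ → r ≤ r′ → c ≤ c′ → ⊥
      q-not-below-p eq′ ep′ _ cq≤cp with refl , refl ← unique eq eq′ | refl , refl ← unique ep ep′ =
        p-before-C-before-q⇒q≰p pC Cq cq≤cp
      rows-qC : ∀ {r c r′ c′} → At X q r c → At X C r′ c′ → r ≢ r′
      rows-qC eq′ eC′ with refl , refl ← unique eq eq′ | refl , refl ← unique eC eC′ = C-before-q⇒rows Cq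

    step-ordered : ReadBefore rp cp rq cq → NextStage i h
    step-ordered pq with ReadBefore-total rC cC rp cp (λ { refl refl → C≢ st p≤ (just-injective (trans (sym eC) ep)) })
    ... | inj₁ Cp = C-first Cp pq
    ... | inj₂ pC with ReadBefore-total rC cC rq cq (λ { refl refl → C≢ st q≤ (just-injective (trans (sym eC) eq)) })
    ...   | inj₁ Cq = C-between pC Cq
    ...   | inj₂ qC = C-last pq qC

  step : ∀ {i h p q} → Stage i h p q → suc (suc i) ≤ n → NextStage i h
  step st C≤n
    with trio-At st C≤n (here refl) | trio-At st C≤n (there (here refl)) | trio-At st C≤n (there (there (here refl)))
  ... | rp , cp , ep | rq , cq , eq | rC , cC , eC
    with ReadBefore-total rp cp rq cq (λ rp≡rq _ → Stage.rowsDiffer st ep eq rp≡rq)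
  ...   | inj₁ pq = step-ordered st ep eq eC pq
  ...   | inj₂ qp = step-ordered (Stage-swap st) eq ep eC qp

  record Run (k : ℕ) (g : ℕ → ℕ) : Set where
    constructor run
    field
      h     : ℕ → ℕ
      p q   : ℕ
      stage : Stage (suc k) h p q
      onT   : chain σ̄ k (map g wT) ≡ just (map h wT)
      onS   : chain σ k (map g wS) ≡ just (map h wS)

  runStages : ∀ {g p q} → Stage 1 g p q → ∀ k → suc (suc k) ≤ n → Run k g
  runStages st₁ zero    _   = run _ _ _ st₁ refl refl
  runStages st₁ (suc k) C≤n with run h p q st onT onS ← runStages st₁ k (<⇒≤ C≤n)
    with nextStage h′ p′ q′ st′ stepT stepS ← step st C≤n =
    run h′ p′ q′ st′ (trans (cong (_>>= σ̄ (suc k)) onT) stepT) (trans (cong (_>>= σ (suc k)) onS) stepS)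

  final-DownClosed : ∀ {m h p q} → suc (suc m) ≡ n → Stage (suc m) h p q →
                     DownClosed (_≢ᵇ suc m) (map (map h) X)
  final-DownClosed {m} {h} {p} {q} n≡ st {r} {c} {v} {r′} {c′} e kept r′≤ c′≤
    with Maybe-map-just⁻ h (trans (sym (entry-map h X r c)) e)
  ... | ℓ , eℓ , refl with IsDiagram-southwest X isDiagram r′≤ c′≤ eℓ
  ...   | ℓ′ , eℓ′ = h ℓ′ , trans (entry-map h X r′ c′) (cong (Maybe.map h) eℓ′) , ≢⇒≢ᵇ (<⇒≢ hℓ′<)
    where
    open Stage st
    ℓ≤n : ℓ ≤ suc (suc m)
    ℓ≤n = subst (ℓ ≤_) (sym n≡) (proj₂ (bounded eℓ))
    ℓ≢p : ℓ ≢ p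
    ℓ≢p refl = ≢ᵇ⇒≢ kept h-p
    ℓ≢q : ℓ ≢ q
    ℓ≢q refl = ≢ᵇ⇒≢ kept h-q
    hℓ′< : h ℓ′ < suc m
    hℓ′< = let ℓ′≢p , ℓ′≢q = corners eℓ ℓ≤n ℓ≢p ℓ≢q eℓ′ r′≤ c′≤ in
           h-rest (proj₁ (bounded eℓ′)) (≤-trans (monotone eℓ′ eℓ r′≤ c′≤) ℓ≤n) ℓ′≢p ℓ′≢q

  module Start (subword₁₂ : filterᵇ (inPair 1 2) wT ≡ 2 ∷ 1 ∷ []) where

    h₁ : ℕ → ℕ
    h₁ = update (_∸ 1) 1 1

    private
      2∈wT : 2 ∈ wT
      2∈wT = proj₁ (∈-filter⁻ (T? ∘ inPair 1 2) (subst (2 ∈_) (sym subword₁₂) (here refl)))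

      two-before-one : LabelReadBefore X 2 1
      two-before-one with subst (AllPairs (LabelReadBefore X)) subword₁₂
                                (AllPairsₚ.filter⁺ (T? ∘ inPair 1 2) (readingWord-sorted X unique))
      ... | (before ∷ []) ∷ _ = before

      1-or-2 : ∀ {ℓ} → 1 ≤ ℓ → ℓ ≤ 2 → ℓ ≢ 2 → ℓ ≢ 1 → ⊥
      1-or-2 {suc zero}          _ _                   _   ℓ≢1 = ℓ≢1 refl
      1-or-2 {suc (suc zero)}    _ _                   ℓ≢2 _   = ℓ≢2 refl
      1-or-2 {suc (suc (suc _))} _ (s≤s (s≤s ()))      _   _

    2≤n : 2 ≤ n
    2≤n = let _ , _ , e₂ = ∈-readingWord⁻ X 2∈wT in proj₂ (bounded e₂)

    1-at-origin : At X 1 0 0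
    1-at-origin = one-at-origin std (≤-trans (s≤s z≤n) 2≤n)

    stage₁ : Stage 1 h₁ 2 1
    stage₁ = record
      { untouched  = λ { (s≤s (s≤s (s≤s _))) → refl }
      ; h-p        = refl
      ; h-q        = refl
      ; p≢q        = λ ()
      ; 1≤p        = s≤s z≤n
      ; 1≤q        = s≤s z≤n
      ; p≤         = ≤-refl
      ; q≤         = s≤s z≤n
      ; h-rest     = λ 1≤ℓ ℓ≤2 ℓ≢2 ℓ≢1 → ⊥-elim (1-or-2 1≤ℓ ℓ≤2 ℓ≢2 ℓ≢1)
      ; corners    = λ eℓ ℓ≤2 ℓ≢2 ℓ≢1 _ _ _ → ⊥-elim (1-or-2 (proj₁ (bounded eℓ)) ℓ≤2 ℓ≢2 ℓ≢1)
      ; rowsDiffer = rowsDiffer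
      }
      where
      rowsDiffer : ∀ {r c r′ c′} → At X 2 r c → At X 1 r′ c′ → r ≢ r′
      rowsDiffer e₂ e₁ r≡r′ =
        above (two-before-one e₂ 1-at-origin) (trans r≡r′ (sym (proj₁ (unique 1-at-origin e₁))))
        where
        above : ∀ {r c} → ReadBefore r c 0 0 → r ≢ 0
        above (inj₁ 0<r)      r≡0 = <-irrefl (sym r≡0) 0<r
        above (inj₂ (_ , ()))

    start : r10→11 (τ₋₁ wT) ≡ just (map h₁ wT) × r01→11 (τ₋₁ wS) ≡ just (map h₁ wS)
    start with _ , _ , e₂ ← ∈-readingWord⁻ X 2∈wT =
      rewriteOn-map 0 1 (((1 ∷ 0 ∷ []) , (1 ∷ 1 ∷ [])) ∷ []) (_∸ 1) h₁ wT subT refl unchanged ,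
      rewriteOn-map 0 1 (((0 ∷ 1 ∷ []) , (1 ∷ 1 ∷ [])) ∷ []) (_∸ 1) h₁ wS subS refl unchanged
      where
      opposite : AllPairs (ReadOppositely X) (2 ∷ 1 ∷ [])
      opposite = (readOppositely X isDiagram unique e₂ 1-at-origin (two-before-one e₂ 1-at-origin)
                    (p-not-strictly-southwest (Stage-swap stage₁) 1-at-origin e₂ (s≤s (s≤s z≤n))) ∷ [])
               ∷ [] ∷ []
      complete : ∀ {x} → x ∈ wT → inPair 0 1 (x ∸ 1) ≡ true → x ∈ 2 ∷ 1 ∷ []
      complete {suc zero}       _ _ = there (here refl)
      complete {suc (suc zero)} _ _ = here refl
      complete {zero}           m _ with () ← proj₁ (bounded (proj₂ (proj₂ (∈-readingWord⁻ X m))))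
      sound : ∀ {x} → x ∈ 2 ∷ 1 ∷ [] → x ∈ wT × inPair 0 1 (x ∸ 1) ≡ true
      sound (here refl)         = 2∈wT , refl
      sound (there (here refl)) = ∈-readingWord⁺ X 1-at-origin , refl
      subwords = subwords-transpose X isDiagram unique (λ x → inPair 0 1 (x ∸ 1)) opposite complete sound
      subT = proj₁ subwords
      subS = proj₂ subwords
      unchanged : ∀ ℓ → inPair 0 1 (ℓ ∸ 1) ≡ false → h₁ ℓ ≡ ℓ ∸ 1
      unchanged zero          _ = refl
      unchanged (suc (suc ℓ)) _ = refl

B₂¹-bar-relabel : ∀ T (h : ℕ → ℕ) →
                  (r10→11 (τ₋₁ (word T)) >>= chain σ̄ (degree T ∸ 2)) ≡ just (map h (word T)) →
                  B₂¹-bar T ≡ just (fromRows (restrict (_≢ᵇ (degree T ∸ 1)) (map (map h) (rows T))))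
B₂¹-bar-relabel T h onT = begin
  B₂¹-bar T
    ≡⟨ cong (λ m → (m >>= λ w → just (tab (shape T) w)) >>= λ U → just (R (degree T ∸ 1) U)) onT ⟩
  just (fromRows (restrict (_≢ᵇ (degree T ∸ 1)) (rows (tab (shape T) (map h (word T))))))
    ≡⟨ cong (λ Y → just (fromRows (restrict (_≢ᵇ (degree T ∸ 1)) Y))) (rows-map h (shape T) (word T)) ⟩
  just (fromRows (restrict (_≢ᵇ (degree T ∸ 1)) (map (map h) (rows T)))) ∎
  where open ≡-Reasoning

B₂¹-relabel : ∀ T (h : ℕ → ℕ) → degree (transpose T) ≡ degree T → IsDiagram (rows T) →
              (r01→11 (τ₋₁ (word (transpose T))) >>= chain σ (degree T ∸ 2)) ≡ just (map h (word (transpose T))) →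
              DownClosed (_≢ᵇ (degree T ∸ 1)) (map (map h) (rows T)) →
              B₂¹ T ≡ just (fromRows (restrict (_≢ᵇ (degree T ∸ 1)) (map (map h) (rows T))))
B₂¹-relabel T h deg diagram onS downClosed = begin
  B₂¹ T
    ≡⟨ cong (λ m → ((m >>= λ w → just (tab (shape S) w)) >>= λ U → just (R (degree S ∸ 1) U))
                   >>= λ U → just (transpose U))
            (subst (λ k → (r01→11 (τ₋₁ (word S)) >>= chain σ (k ∸ 2)) ≡ just (map h (word S))) (sym deg) onS) ⟩
  just (fromRows (cols (rows (fromRows (restrict (P (degree S)) (rows (tab (shape S) (map h (word S)))))))))
    ≡⟨ cong (λ Y → just (fromRows (cols Y)))
            (rows-fromRows (restrict (P (degree S)) (rows (tab (shape S) (map h (word S)))))) ⟩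
  just (fromRows (cols (restrict (P (degree S)) (rows (tab (shape S) (map h (word S)))))))
    ≡⟨ cong₂ (λ k Y → just (fromRows (cols (restrict (P k) Y)))) deg
             (trans (rows-map h (shape S) (word S)) (cong (map (map h)) (rows-fromRows (cols X)))) ⟩
  just (fromRows (cols (restrict (P (degree T)) (map (map h) (cols X)))))
    ≡⟨ cong (just ∘ fromRows) (cols-restrict (P (degree T)) (map (map h) (cols X)) (map (map h) X)
                                          (Transposed-map h (cols X) X (entry-cols X diagram)) downClosed) ⟩
  just (fromRows (restrict (P (degree T)) (map (map h) X))) ∎
  where
  open ≡-Reasoning
  S = transpose T
  X = rows T
  P : ℕ → ℕ → Bool
  P k = _≢ᵇ (k ∸ 1)

module _ {T : Tableau} (isStd : IsStandard T) where
  private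
    X = rows T
    std = isStandardRows T isStd
    len = proj₁ (proj₂ (proj₁ isStd))
    open IsStandardRows std
    open Stages std

  degree-transpose : degree (transpose T) ≡ degree T
  degree-transpose = begin
    degree (fromRows (cols X)) ≡⟨ degree-fromRows (cols X) ⟩
    length wS                  ≡⟨ length-readingWord-cols X isDiagram unique ⟩
    length wT                  ≡⟨ cong length (readingWord-rows T len) ⟩
    length (word T)            ≡⟨ len ⟩
    degree T                   ∎
    where open ≡-Reasoning

  record Relabelling : Set where
    field
      h          : ℕ → ℕ
      onT        : (r10→11 (τ₋₁ (word T)) >>= chain σ̄ (degree T ∸ 2)) ≡ just (map h (word T))
      onS        : (r01→11 (τ₋₁ (word (transpose T))) >>= chain σ (degree T ∸ 2)) ≡ just (map h (word (transpose T)))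
      downClosed : DownClosed (_≢ᵇ (degree T ∸ 1)) (map (map h) X)

  relabelling : subword₂ 1 2 (word T) ≡ 2 ∷ 1 ∷ [] → Relabelling
  relabelling subword₁₂ = record
    { h          = Run.h final
    ; onT        = subst₂ (λ k w → (r10→11 (τ₋₁ w) >>= chain σ̄ (k ∸ 2)) ≡ just (map (Run.h final) w)) n≡ wT≡
                          (trans (cong (_>>= chain σ̄ m) (proj₁ start)) (Run.onT final))
    ; onS        = subst (λ k → (r01→11 (τ₋₁ wS) >>= chain σ (k ∸ 2)) ≡ just (map (Run.h final) wS)) n≡
                         (trans (cong (_>>= chain σ m) (proj₂ start)) (Run.onS final))
    ; downClosed = subst (λ k → DownClosed (_≢ᵇ (k ∸ 1)) (map (map (Run.h final)) X)) n≡
                         (final-DownClosed n≡ (Run.stage final))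
    }
    where
    wT≡ : wT ≡ word T
    wT≡ = readingWord-rows T len
    open Start (subst (λ w → subword₂ 1 2 w ≡ 2 ∷ 1 ∷ []) (sym wT≡) subword₁₂)
    m = proj₁ (m≤n⇒∃[o]m+o≡n 2≤n)
    n≡ : suc (suc m) ≡ degree T
    n≡ = proj₂ (m≤n⇒∃[o]m+o≡n 2≤n)
    final = runStages stage₁ m (≤-reflexive n≡)

mainTheorem16 : (T : Tableau) → IsStandard T → subword₂ 1 2 (word T) ≡ 2 ∷ 1 ∷ []
    → ∃[ U ] (B₂¹ T ≡ just U × B₂¹-bar T ≡ just U)
mainTheorem16 T isStd subword₁₂ =
  _ , B₂¹-relabel T h (degree-transpose isStd) (IsStandardRows.isDiagram (isStandardRows T isStd)) onS downClosed
    , B₂¹-bar-relabel T h onT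
  where open Relabelling (relabelling isStd subword₁₂)
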